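{- Let $G$ be a graph on $n$ vertices with $n$ odd. (i) If $G$ is a weakly $(n,\beta)$-graph with $0<\beta\le 1/3$, then $G$ is factor-critical. (ii) If $G$ is an $(n,\beta)$-graph with $0<\beta\le 1/2$, then $G$ is factor-critical.
   Context: All graphs are finite, simple and nonempty. A graph $G$ is factor-critical if $G-v$ has a perfect matching for every vertex $v$. For vertex sets $X,Y$, $e(X,Y)$ is the number of edges with one end in $X$ and the other in $Y$ (edges with both ends in $X\cap Y$ counted twice). For $\beta>0$, a graph on $n$ vertices is a weakly $(n,\beta)$-graph if $\frac{|X||Y|}{(n-|X|)(n-|Y|)}\le\beta^2$ for every pair of disjoint proper subsets $X,Y$ of $V(G)$ with no edge between them; it is an $(n,\beta)$-graph if this inequality holds for every pair of (not necessarily disjoint) proper subsets $X,Y$ with $e(X,Y)=0$. By convention $K_n$ is an $(n,\beta)$-graph for every $\beta>0$.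
   Formalization: The parameter β ranges over the rationals. -}

module Defs where

open import Data.Nat using (ℕ; _∸_; _+_; _*_)
open import Data.Bool using (Bool; true; false)
open import Data.Fin using (Fin)
open import Data.Fin.Subset using (Subset; ∣_∣; _∈_; ⊤; Empty)
open import Data.Product using (_×_; ∃)
open import Data.Sum using (_⊎_)
open import Relation.Binary.PropositionalEquality using (_≡_; _≢_)
open import Data.Rational using (ℚ; _≤_; _<_; 0ℚ)
import Data.Rational as ℚ
import Data.Integer as ℤ

record Graph (n : ℕ) : Set where
  field
    adj   : Fin n → Fin n → Bool
    sym   : ∀ u v → adj u v ≡ adj v u
    loopless : ∀ v → adj v v ≡ false
open Graph public

Odd : ℕ → Set
Odd n = ∃ λ k → n ≡ 1 + 2 * k

Disjoint : ∀ {n} → Subset n → Subset n → Set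
Disjoint {n} X Y = ∀ (v : Fin n) → v ∈ X → v ∈ Y → Data.Empty.⊥
  where import Data.Empty

-- e(X,Y) = 0 : no edge with one end in X and the other in Y
-- (an edge inside X ∩ Y is also such an edge, so this covers that case)
NoEdge : ∀ {n} → Graph n → Subset n → Subset n → Set
NoEdge G X Y = ∀ x y → x ∈ X → y ∈ Y → adj G x y ≡ false

-- |X||Y| / ((n-|X|)(n-|Y|)) ≤ β², with the (positive) denominator cleared
RatioBound : (n : ℕ) → ℚ → Subset n → Subset n → Set
RatioBound n β X Y =
  (ℤ.+ (∣ X ∣ * ∣ Y ∣)) ℚ./ 1
    ≤ (β ℚ.* β) ℚ.* ((ℤ.+ ((n ∸ ∣ X ∣) * (n ∸ ∣ Y ∣))) ℚ./ 1)

WeaklyNBetaGraph : (n : ℕ) → Graph n → ℚ → Set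
WeaklyNBetaGraph n G β =
  ∀ (X Y : Subset n) → X ≢ ⊤ → Y ≢ ⊤ → Disjoint X Y → NoEdge G X Y →
  RatioBound n β X Y

IsComplete : ∀ {n} → Graph n → Set
IsComplete G = ∀ u v → u ≢ v → adj G u v ≡ true

-- (n,β)-graph (K_n is one by convention)
NBetaGraph : (n : ℕ) → Graph n → ℚ → Set
NBetaGraph n G β =
  IsComplete G ⊎
  (∀ (X Y : Subset n) → X ≢ ⊤ → Y ≢ ⊤ → NoEdge G X Y → RatioBound n β X Y)

HasPerfectMatchingMinus : ∀ {n} → Graph n → Fin n → Set
HasPerfectMatchingMinus {n} G v =
  ∃ λ (p : Fin n → Fin n) → ∀ u → u ≢ v →
    (p u ≢ v) × (adj G u (p u) ≡ true) × (p (p u) ≡ u)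

FactorCritical : ∀ {n} → Graph n → Set
FactorCritical {n} G = ∀ (v : Fin n) → HasPerfectMatchingMinus G v

{-# OPTIONS --safe #-}
-- Fix a vertex v and let W = V ∖ {v}, a set of even size. By Tutte's theorem G[W] has a perfect
-- matching unless some S ⊆ W leaves at least |S| + 2 components in G[W] − S. It is proved by
-- induction on the number of non-edges: if a vertex b not adjacent to all of W is the middle of an
-- induced path a b c, pick d ∈ W not adjacent to b; perfect matchings of G + ac and of G + bd combine
-- along an alternating walk into one of G. Otherwise the components of G[W] − S, for S the vertices
-- adjacent to all of W, are cliques, and matching greedily either succeeds or exhibits S.
--
-- Given such an S, put s = |S| + 1 and split the components into two halves with unions A and B.
-- No edge joins A and B, while n − |A| = s + |B| and n − |B| = s + |A|. In (i) the weak condition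
-- gives 9|A||B| ≤ (s + |B|)(s + |A|), which fails as 2|A| ≥ s and 2|B| > s. In (ii) the union I of
-- the singleton components spans no edge and may be added to both sides; the other components have
-- at least two vertices, so |A| + 2|I| ≥ s and |B| + 2|I| > s, contradicting
-- 4(|A| + |I|)(|B| + |I|) ≤ (s + |B|)(s + |A|). A complete graph has no such S at all.
module Submission where

open import Data.Nat using (ℕ)
open import Data.Product using (_×_; _,_)
open import Data.Sum using (inj₁; inj₂)
import Data.Integer as ℤ
open import Defs renaming (sym to adj-sym)

-- ℕ's _≤_ and _<_ are opened only inside this module, leaving those of ℚ to the statement below.
module _ where

  open import Data.Bool using (Bool; true; false; not; _∧_; _∨_; if_then_else_) renaming (_≟_ to _≟ᵇ_)
  open import Data.Bool.Properties using (∧-comm; ∨-comm; ∧-zeroʳ; ∧-identityʳ; not-injective; not-¬; ¬-not)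
  open import Data.Empty using (⊥-elim)
  open import Data.Fin using (Fin; zero; suc; toℕ)
  open import Data.Fin.Properties using (_≟_; pigeonhole; toℕ<n)
  open import Data.Fin.Subset using (Subset; ∣_∣; ⊤) renaming (_∈_ to _∈ˢ_)
  open import Data.Nat using (zero; suc; _+_; _*_; _∸_; _≤_; _<_; z≤n; s≤s; >-nonZero)
  open import Data.Nat.Induction using (<-wellFounded)
  open import Data.Nat.Properties hiding (_≟_)
  open import Data.Nat.Tactic.RingSolver using (solve-∀)
  open import Data.Nat.Coprimality using (1-coprimeTo) renaming (sym to coprime-sym)
  open import Data.Product using (∃; proj₁; proj₂)
  open import Data.Sum using (_⊎_; [_,_]′; map₂)
  open import Data.Vec using (tabulate; lookup)
  open import Data.Vec.Properties using (lookup∘tabulate; []=⇒lookup; lookup-replicate)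
  import Data.Integer.Properties as ℤ
  open import Data.Rational using (ℚ; 0ℚ; ½; _/_; mkℚ; toℚᵘ; NonNegative; positive)
    renaming (_≤_ to _≤ℚ_; _<_ to _<ℚ_; _*_ to _*ℚ_)
  import Data.Rational.Properties as ℚ
  import Data.Rational.Unnormalised as ℚᵘ
  import Data.Rational.Unnormalised.Properties as ℚᵘ
  open import Algebra.Properties.CommutativeSemigroup +-commutativeSemigroup using (interchange; x∙yz≈y∙xz)
  open import Function using (_∘_)
  open import Induction.WellFounded using (WellFounded; module All)
  open import Relation.Binary.Construct.On using (wellFounded)
  open import Relation.Nullary using (¬_; yes; no; does; contradiction)
  open import Relation.Binary.PropositionalEquality
    using (_≡_; _≢_; refl; sym; trans; cong; cong₂; subst; subst₂; module ≡-Reasoning)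

  private variable
    n : ℕ

  true≢false : true ≢ false
  true≢false ()

  not-true⇒false : ∀ {a} → not a ≡ true → a ≡ false
  not-true⇒false {false} _ = refl

  not-false⇒true : ∀ {a} → not a ≡ false → a ≡ true
  not-false⇒true {true} _ = refl

  false⇒not-true : ∀ {a} → a ≡ false → not a ≡ true
  false⇒not-true refl = refl

  ∧-elimˡ : ∀ {a b} → (a ∧ b) ≡ true → a ≡ true
  ∧-elimˡ {true} _ = refl

  ∧-elimʳ : ∀ {a b} → (a ∧ b) ≡ true → b ≡ true
  ∧-elimʳ {true} p = p

  ∧-elim : ∀ {a b} → (a ∧ b) ≡ true → a ≡ true × b ≡ true
  ∧-elim {true} p = refl , p

  ∧-intro : ∀ {a b} → a ≡ true → b ≡ true → (a ∧ b) ≡ true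
  ∧-intro refl refl = refl

  ∧-true⇒false : ∀ {a b} → a ≡ true → (a ∧ b) ≡ false → b ≡ false
  ∧-true⇒false refl p = p

  ∨-elim : ∀ {a b} → (a ∨ b) ≡ true → a ≡ true ⊎ b ≡ true
  ∨-elim {true} _ = inj₁ refl
  ∨-elim {false} p = inj₂ p

  ∨-introˡ : ∀ {a b} → a ≡ true → (a ∨ b) ≡ true
  ∨-introˡ refl = refl

  ∨-introʳ : ∀ {a b} → b ≡ true → (a ∨ b) ≡ true
  ∨-introʳ {a = true} _ = refl
  ∨-introʳ {a = false} p = p

  ≢true⇒false : ∀ {a} → a ≢ true → a ≡ false
  ≢true⇒false {false} _ = refl
  ≢true⇒false {true} p = contradiction refl p

  if-true : ∀ {A : Set} {c} {x y : A} → c ≡ true → (if c then x else y) ≡ x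
  if-true refl = refl

  if-false : ∀ {A : Set} {c} {x y : A} → c ≡ false → (if c then x else y) ≡ y
  if-false refl = refl

  _==_ : Fin n → Fin n → Bool
  x == y = does (x ≟ y)

  ==-refl : (x : Fin n) → (x == x) ≡ true
  ==-refl x with x ≟ x
  ... | yes _ = refl
  ... | no x≢x = contradiction refl x≢x

  ==⇒≡ : {x y : Fin n} → (x == y) ≡ true → x ≡ y
  ==⇒≡ {x = x} {y} p with x ≟ y
  ... | yes x≡y = x≡y

  ≢⇒==-false : {x y : Fin n} → x ≢ y → (x == y) ≡ false
  ≢⇒==-false {x = x} {y} x≢y with x ≟ y
  ... | yes x≡y = contradiction x≡y x≢y
  ... | no _ = refl

  ==-false⇒≢ : {x y : Fin n} → (x == y) ≡ false → x ≢ y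
  ==-false⇒≢ {x = x} p refl = true≢false (trans (sym (==-refl x)) p)

  VSet : ℕ → Set
  VSet n = Fin n → Bool

  _⊆_ : VSet n → VSet n → Set
  P ⊆ Q = ∀ x → P x ≡ true → Q x ≡ true

  ⊆-trans : ∀ {P Q R : VSet n} → P ⊆ Q → Q ⊆ R → P ⊆ R
  ⊆-trans P⊆Q Q⊆R x = Q⊆R x ∘ P⊆Q x

  _∖_ : VSet n → VSet n → VSet n
  (P ∖ Q) x = P x ∧ not (Q x)

  ∖-monoˡ : ∀ {P P′ : VSet n} (Q : VSet n) → P ⊆ P′ → (P ∖ Q) ⊆ (P′ ∖ Q)
  ∖-monoˡ {P = P} Q P⊆P′ x p = ∧-intro (P⊆P′ x (∧-elimˡ p)) (∧-elimʳ {P x} p)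

  _∩_ _∪_ : VSet n → VSet n → VSet n
  (P ∩ Q) x = P x ∧ Q x
  (P ∪ Q) x = P x ∨ Q x

  _─_ : VSet n → Fin n → VSet n
  P ─ v = P ∖ (_== v)

  ∖-elimʳ : ∀ (P Q : VSet n) {x} → (P ∖ Q) x ≡ true → Q x ≡ false
  ∖-elimʳ P Q {x} p = not-true⇒false (∧-elimʳ {P x} p)

  ∖-intro : ∀ (P Q : VSet n) {x} → P x ≡ true → Q x ≡ false → (P ∖ Q) x ≡ true
  ∖-intro P Q p q = ∧-intro p (false⇒not-true q)

  ─-elimʳ : ∀ (P : VSet n) {v x} → (P ─ v) x ≡ true → x ≢ v
  ─-elimʳ P {v} p = ==-false⇒≢ (∖-elimʳ P (_== v) p)

  ─-intro : ∀ (P : VSet n) {v x} → P x ≡ true → x ≢ v → (P ─ v) x ≡ true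
  ─-intro P {v} {x} p x≢v = ∖-intro P (_== v) {x} p (≢⇒==-false x≢v)

  ─-⊆ : ∀ (P : VSet n) {v} → (P ─ v) ⊆ P
  ─-⊆ P x = ∧-elimˡ

  ⊆-─ : ∀ {P Q : VSet n} {v} → P ⊆ Q → P v ≡ false → P ⊆ (Q ─ v)
  ⊆-─ {Q = Q} P⊆Q Pv x Px = ─-intro Q (P⊆Q x Px) λ { refl → true≢false (trans (sym Px) Pv) }

  ─-same : ∀ (P : VSet n) {v x} → x ≢ v → (P ─ v) x ≡ P x
  ─-same P {x = x} x≢v rewrite ≢⇒==-false x≢v = ∧-identityʳ (P x)

  ─∖─ : ∀ (P Q : VSet n) {v} → ((P ─ v) ∖ (Q ─ v)) ⊆ (P ∖ Q)
  ─∖─ P Q {v} x p =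
    ∖-intro P Q (∧-elimˡ (∧-elimˡ p))
      (trans (sym (─-same Q (─-elimʳ P (∧-elimˡ p)))) (∖-elimʳ (P ─ v) (Q ─ v) p))

  bit : Bool → ℕ
  bit true = 1
  bit false = 0

  count : VSet n → ℕ
  count {zero} P = 0
  count {suc n} P = bit (P zero) + count (P ∘ suc)

  count-cong : ∀ {P Q : VSet n} → (∀ x → P x ≡ Q x) → count P ≡ count Q
  count-cong {zero} _ = refl
  count-cong {suc n} P≗Q = cong₂ _+_ (cong bit (P≗Q zero)) (count-cong (P≗Q ∘ suc))

  count-mono : ∀ {P Q : VSet n} → P ⊆ Q → count P ≤ count Q
  count-mono {zero} _ = z≤n
  count-mono {suc n} {P} P⊆Q = +-mono-≤ (bit-mono (P⊆Q zero)) (count-mono (P⊆Q ∘ suc))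
    where
    bit-mono : ∀ {a b} → (a ≡ true → b ≡ true) → bit a ≤ bit b
    bit-mono {false} _ = z≤n
    bit-mono {true} p rewrite p refl = ≤-refl

  count-∖ : ∀ (P Q : VSet n) → count P ≡ count (P ∩ Q) + count (P ∖ Q)
  count-∖ {zero} P Q = refl
  count-∖ {suc n} P Q = begin
    bit (P zero) + count (P ∘ suc)
      ≡⟨ cong₂ _+_ (bit-split (P zero) (Q zero)) (count-∖ (P ∘ suc) (Q ∘ suc)) ⟩
    (bit ((P ∩ Q) zero) + bit ((P ∖ Q) zero)) + (count ((P ∩ Q) ∘ suc) + count ((P ∖ Q) ∘ suc))
      ≡⟨ interchange (bit ((P ∩ Q) zero)) (bit ((P ∖ Q) zero)) _ _ ⟩
    count (P ∩ Q) + count (P ∖ Q) ∎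
    where
    open ≡-Reasoning
    bit-split : ∀ a b → bit a ≡ bit (a ∧ b) + bit (a ∧ not b)
    bit-split false _ = refl
    bit-split true false = refl
    bit-split true true = refl

  count-false : ∀ {P : VSet n} → (∀ x → P x ≡ false) → count P ≡ 0
  count-false {zero} _ = refl
  count-false {suc n} {P} P≡false rewrite P≡false zero = count-false (P≡false ∘ suc)

  count-all : count {n} (λ _ → true) ≡ n
  count-all {zero} = refl
  count-all {suc n} = cong suc (count-all {n})

  count-pos⇒∃ : ∀ (P : VSet n) → 0 < count P → ∃ λ x → P x ≡ true
  count-pos⇒∃ {suc n} P pos with P zero in P0
  ... | true = zero , P0
  ... | false with count-pos⇒∃ (P ∘ suc) pos
  ...   | x , Px = suc x , Px

  count-∩-single : ∀ (P : VSet n) v → P v ≡ true → count (P ∩ (_== v)) ≡ 1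
  count-∩-single {suc n} P zero Pv rewrite Pv = cong suc (count-false (λ x → ∧-zeroʳ (P (suc x))))
  count-∩-single {suc n} P (suc v) Pv with P zero
  ... | false = count-∩-single (P ∘ suc) v Pv
  ... | true = count-∩-single (P ∘ suc) v Pv

  count-single : ∀ (v : Fin n) → count (_== v) ≡ 1
  count-single v = count-∩-single (λ _ → true) v refl

  count-─ : ∀ (P : VSet n) {v} → P v ≡ true → count P ≡ suc (count (P ─ v))
  count-─ P {v} Pv = begin
    count P                               ≡⟨ count-∖ P (_== v) ⟩
    count (P ∩ (_== v)) + count (P ─ v)   ≡⟨ cong (_+ count (P ─ v)) (count-∩-single P v Pv) ⟩
    suc (count (P ─ v))                   ∎
    where open ≡-Reasoning

  count≡0⇒∅ : ∀ (P : VSet n) → count P ≡ 0 → ∀ x → P x ≡ false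
  count≡0⇒∅ P |P|≡0 x = ≢true⇒false λ Px → 0≢1+n (trans (sym |P|≡0) (count-─ P Px))

  count-∖-⊆ : ∀ {P Q : VSet n} → Q ⊆ P → count P ≡ count Q + count (P ∖ Q)
  count-∖-⊆ {P = P} {Q} Q⊆P =
    trans (count-∖ P Q) (cong (_+ count (P ∖ Q)) (count-cong restrict))
    where
    restrict : ∀ x → (P x ∧ Q x) ≡ Q x
    restrict x with Q x in Qx
    ... | false = ∧-zeroʳ (P x)
    ... | true rewrite Q⊆P x Qx = refl

  count-< : ∀ {P Q : VSet n} → P ⊆ Q → ∀ {v} → Q v ≡ true → P v ≡ false → count P < count Q
  count-< {P = P} {Q} P⊆Q {v} Qv Pv = begin-strict
    count P                   <⟨ m<m+n (count P) (subst (0 <_) (sym (count-─ (Q ∖ P) (∖-intro Q P Qv Pv))) (s≤s z≤n)) ⟩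
    count P + count (Q ∖ P)   ≡⟨ sym (count-∖-⊆ P⊆Q) ⟩
    count Q                   ∎
    where open ≤-Reasoning

  ∃-subset-of-size : ∀ (P : VSet n) m → m ≤ count P → ∃ λ Q → Q ⊆ P × count Q ≡ m
  ∃-subset-of-size {n} P zero _ = (λ _ → false) , (λ _ ()) , count-false {n} {λ _ → false} (λ _ → refl)
  ∃-subset-of-size {suc n} P (suc m) m<P with P zero in P0
  ... | true with ∃-subset-of-size (P ∘ suc) m (≤-pred m<P)
  ...   | Q , Q⊆P , |Q| = (λ { zero → true ; (suc x) → Q x }) , (λ { zero _ → P0 ; (suc x) → Q⊆P x }) , cong suc |Q|
  ∃-subset-of-size {suc n} P (suc m) m<P | false with ∃-subset-of-size (P ∘ suc) (suc m) m<P
  ...   | Q , Q⊆P , |Q| = (λ { zero → false ; (suc x) → Q x }) , (λ { zero () ; (suc x) → Q⊆P x }) , |Q|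

  InjectiveOn : VSet n → (Fin n → Fin n) → Set
  InjectiveOn P f = ∀ x y → P x ≡ true → P y ≡ true → f x ≡ f y → x ≡ y

  count-≤-image : ∀ (P Q : VSet n) (f : Fin n → Fin n) →
    (∀ x → P x ≡ true → Q (f x) ≡ true) → InjectiveOn P f → count P ≤ count Q
  count-≤-image P Q f = go (count P) P Q refl
    where
    go : ∀ k (P Q : VSet _) → count P ≡ k →
         (∀ x → P x ≡ true → Q (f x) ≡ true) → InjectiveOn P f → k ≤ count Q
    go zero P Q _ _ _ = z≤n
    go (suc k) P Q |P| maps inj with count-pos⇒∃ P (subst (0 <_) (sym |P|) (s≤s z≤n))
    ... | v , Pv = subst (suc k ≤_) (sym (count-─ Q (maps v Pv)))
                     (s≤s (go k (P ─ v) (Q ─ f v) |P-v| maps′ inj′))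
      where
      |P-v| : count (P ─ v) ≡ k
      |P-v| = suc-injective (trans (sym (count-─ P Pv)) |P|)
      maps′ : ∀ x → (P ─ v) x ≡ true → (Q ─ f v) (f x) ≡ true
      maps′ x p = ─-intro Q (maps x (∧-elimˡ p)) (λ fx≡fv → ─-elimʳ P p (inj x v (∧-elimˡ p) Pv fx≡fv))
      inj′ : InjectiveOn (P ─ v) f
      inj′ x y p q = inj x y (∧-elimˡ p) (∧-elimˡ q)

  count-≥-double : ∀ {P Z : VSet n} (f : Fin n → Fin n) → P ⊆ Z →
    (∀ x → P x ≡ true → (Z ∖ P) (f x) ≡ true) → InjectiveOn P f → count P + count P ≤ count Z
  count-≥-double {P = P} {Z} f P⊆Z maps inj =
    subst (count P + count P ≤_) (sym (count-∖-⊆ P⊆Z)) (+-monoʳ-≤ (count P) (count-≤-image P (Z ∖ P) f maps inj))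

  halve : ∀ t → ∃ λ m → m + m ≤ t × t ≤ suc (m + m)
  halve zero = 0 , z≤n , z≤n
  halve (suc zero) = 0 , z≤n , ≤-refl
  halve (suc (suc t)) with halve t
  ... | m , 2m≤t , t≤1+2m = suc m , subst (_≤ suc (suc t)) (sym 2+2m) (s≤s (s≤s 2m≤t)) ,
                            subst (suc (suc t) ≤_) (cong suc (sym 2+2m)) (s≤s (s≤s t≤1+2m))
    where
    2+2m : suc m + suc m ≡ suc (suc (m + m))
    2+2m = cong suc (+-suc m m)

  record Halves (P : VSet n) : Set where
    field
      P₁ : VSet n
      P₁⊆P : P₁ ⊆ P
      |P|≤1+2|P₁| : count P ≤ suc (count P₁ + count P₁)
      |P|≤2|P∖P₁| : count P ≤ count (P ∖ P₁) + count (P ∖ P₁)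

  halves : ∀ (P : VSet n) → Halves P
  halves P with halve (count P)
  ... | m , 2m≤t , t≤1+2m with ∃-subset-of-size P m (≤-trans (m≤m+n m m) 2m≤t)
  ...   | P₁ , P₁⊆P , |P₁|≡m = record
    { P₁ = P₁ ; P₁⊆P = P₁⊆P
    ; |P|≤1+2|P₁| = subst (λ k → count P ≤ suc (k + k)) (sym |P₁|≡m) t≤1+2m
    ; |P|≤2|P∖P₁| = subst (_≤ count (P ∖ P₁) + count (P ∖ P₁)) (sym |P|≡) (+-monoˡ-≤ (count (P ∖ P₁)) m≤|P∖P₁|)
    }
    where
    |P|≡ : count P ≡ m + count (P ∖ P₁)
    |P|≡ = trans (count-∖-⊆ P₁⊆P) (cong (_+ count (P ∖ P₁)) |P₁|≡m)
    m≤|P∖P₁| : m ≤ count (P ∖ P₁)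
    m≤|P∖P₁| = +-cancelˡ-≤ m m _ (subst (m + m ≤_) |P|≡ 2m≤t)

  count-∪ : ∀ (P Q : VSet n) → (∀ x → P x ≡ true → Q x ≡ false) →
    count (P ∪ Q) ≡ count P + count Q
  count-∪ P Q disjoint = trans (count-∖ (P ∪ Q) P) (cong₂ _+_ (count-cong on-P) (count-cong off-P))
    where
    on-P : ∀ x → ((P x ∨ Q x) ∧ P x) ≡ P x
    on-P x with P x
    ... | true = refl
    ... | false = ∧-zeroʳ (Q x)
    off-P : ∀ x → ((P x ∨ Q x) ∧ not (P x)) ≡ Q x
    off-P x with P x in Px
    ... | true = sym (disjoint x Px)
    ... | false = ∧-identityʳ (Q x)

  anyᵇ : VSet n → Bool
  anyᵇ {zero} P = false
  anyᵇ {suc n} P = P zero ∨ anyᵇ (P ∘ suc)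

  anyᵇ-true : ∀ (P : VSet n) → anyᵇ P ≡ true → ∃ λ x → P x ≡ true
  anyᵇ-true {suc n} P p with ∨-elim {P zero} p
  ... | inj₁ P0 = zero , P0
  ... | inj₂ q with anyᵇ-true (P ∘ suc) q
  ...   | x , Px = suc x , Px

  anyᵇ-false : ∀ (P : VSet n) → anyᵇ P ≡ false → ∀ x → P x ≡ false
  anyᵇ-false {suc n} P p zero with P zero
  ... | false = refl
  anyᵇ-false {suc n} P p (suc x) with P zero
  ... | false = anyᵇ-false (P ∘ suc) p x

  anyᵇ-intro : ∀ (P : VSet n) {x} → P x ≡ true → anyᵇ P ≡ true
  anyᵇ-intro P {x} Px with anyᵇ P in e
  ... | true = refl
  ... | false = contradiction (trans (sym Px) (anyᵇ-false P e x)) true≢false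

  search : ∀ (P : VSet n) → (∃ λ x → P x ≡ true) ⊎ (∀ x → P x ≡ false)
  search P with anyᵇ P in e
  ... | true = inj₁ (anyᵇ-true P e)
  ... | false = inj₂ (anyᵇ-false P e)

  Even : ℕ → Set
  Even m = ∃ λ k → m ≡ k + k

  even-pred² : ∀ {m} → Even (suc (suc m)) → Even m
  even-pred² (suc k , e) = k , suc-injective (trans (suc-injective e) (+-suc k k))

  ¬even-1 : ¬ Even 1
  ¬even-1 (suc k , e) with trans (suc-injective e) (+-suc k k)
  ... | ()

  even-pos⇒≥2 : ∀ {m} → Even m → 0 < m → 2 ≤ m
  even-pos⇒≥2 {suc zero} e _ = contradiction e ¬even-1
  even-pos⇒≥2 {suc (suc m)} _ _ = s≤s (s≤s z≤n)

  ∑ : (Fin n → ℕ) → ℕ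
  ∑ {zero} f = 0
  ∑ {suc n} f = f zero + ∑ (f ∘ suc)

  ∑-mono : ∀ {f g : Fin n → ℕ} → (∀ x → f x ≤ g x) → ∑ f ≤ ∑ g
  ∑-mono {zero} _ = z≤n
  ∑-mono {suc n} f≤g = +-mono-≤ (f≤g zero) (∑-mono (f≤g ∘ suc))

  ∑-< : ∀ {f g : Fin n → ℕ} → (∀ x → f x ≤ g x) → ∀ v → f v < g v → ∑ f < ∑ g
  ∑-< {suc n} f≤g zero fv<gv = +-mono-<-≤ fv<gv (∑-mono (f≤g ∘ suc))
  ∑-< {suc n} f≤g (suc v) fv<gv = +-mono-≤-< (f≤g zero) (∑-< (f≤g ∘ suc) v fv<gv)

  adj⇒≢ : ∀ (H : Graph n) {x y} → adj H x y ≡ true → x ≢ y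
  adj⇒≢ H {x} xy refl = true≢false (trans (sym xy) (loopless H x))

  adj-symmetric : ∀ (H : Graph n) {x y} → adj H x y ≡ true → adj H y x ≡ true
  adj-symmetric H {x} {y} xy = trans (adj-sym H y x) xy

  _⊑_ : Graph n → Graph n → Set
  G ⊑ H = ∀ x y → adj G x y ≡ true → adj H x y ≡ true

  isPair : Fin n → Fin n → Fin n → Fin n → Bool
  isPair x y u v = (u == x ∧ v == y) ∨ (u == y ∧ v == x)

  isPair-elim : ∀ {x y u v : Fin n} → isPair x y u v ≡ true → (u ≡ x × v ≡ y) ⊎ (u ≡ y × v ≡ x)
  isPair-elim {u = u} {v} p with ∨-elim {u == _ ∧ v == _} p
  ... | inj₁ q = inj₁ (==⇒≡ (∧-elimˡ q) , ==⇒≡ (∧-elimʳ {u == _} q))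
  ... | inj₂ q = inj₂ (==⇒≡ (∧-elimˡ q) , ==⇒≡ (∧-elimʳ {u == _} q))

  addEdge : (H : Graph n) (x y : Fin n) → x ≢ y → Graph n
  addEdge H x y x≢y = record
    { adj = λ u v → adj H u v ∨ isPair x y u v
    ; sym = λ u v → cong₂ _∨_ (adj-sym H u v) (isPair-sym u v)
    ; loopless = λ u → cong₂ _∨_ (loopless H u) (isPair-irreflexive u)
    }
    where
    isPair-sym : ∀ u v → isPair x y u v ≡ isPair x y v u
    isPair-sym u v = trans (∨-comm (u == x ∧ v == y) _) (cong₂ _∨_ (∧-comm (u == y) _) (∧-comm (u == x) _))
    isPair-irreflexive : ∀ u → isPair x y u u ≡ false
    isPair-irreflexive u = ≢true⇒false λ p →
      [ (λ (u≡x , u≡y) → x≢y (trans (sym u≡x) u≡y)) , (λ (u≡y , u≡x) → x≢y (trans (sym u≡x) u≡y)) ]′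
        (isPair-elim {x = x} {y} {u} {u} p)

  ⊑-addEdge : ∀ (H : Graph n) x y x≢y → H ⊑ addEdge H x y x≢y
  ⊑-addEdge H x y x≢y u v = ∨-introˡ

  addEdge-adj : ∀ (H : Graph n) x y x≢y → adj (addEdge H x y x≢y) x y ≡ true
  addEdge-adj H x y x≢y = ∨-introʳ {a = adj H x y} (∨-introˡ (∧-intro (==-refl x) (==-refl y)))

  addEdge-elim : ∀ (H : Graph n) x y x≢y {u v} → adj (addEdge H x y x≢y) u v ≡ true →
    adj H u v ≡ true ⊎ ((u ≡ x × v ≡ y) ⊎ (u ≡ y × v ≡ x))
  addEdge-elim H x y x≢y {u} {v} p with ∨-elim {adj H u v} p
  ... | inj₁ q = inj₁ q
  ... | inj₂ q = inj₂ (isPair-elim q)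

  nonAdjacencies : Graph n → ℕ
  nonAdjacencies H = ∑ λ x → count (not ∘ adj H x)

  nonAdjacencies-addEdge : ∀ (H : Graph n) x y x≢y → adj H x y ≡ false →
    nonAdjacencies (addEdge H x y x≢y) < nonAdjacencies H
  nonAdjacencies-addEdge H x y x≢y xy∉H =
    ∑-< (λ u → count-mono (fewer u)) x (count-< (fewer x) (false⇒not-true xy∉H) (cong not (addEdge-adj H x y x≢y)))
    where
    fewer : ∀ u → (not ∘ adj (addEdge H x y x≢y) u) ⊆ (not ∘ adj H u)
    fewer u z p = false⇒not-true (≢true⇒false λ uz∈H →
      true≢false (trans (sym p) (cong not (⊑-addEdge H x y x≢y u z uz∈H))))

  IsPerfectMatchingOn : Graph n → VSet n → (Fin n → Fin n) → Set
  IsPerfectMatchingOn H W p =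
    ∀ u → W u ≡ true → (W (p u) ≡ true) × (adj H u (p u) ≡ true) × (p (p u) ≡ u)

  PerfectMatchingOn : Graph n → VSet n → Set
  PerfectMatchingOn H W = ∃ (IsPerfectMatchingOn H W)

  perfectMatching-empty : ∀ (H : Graph n) {W : VSet n} → (∀ u → W u ≡ false) → PerfectMatchingOn H W
  perfectMatching-empty H W≡∅ = (λ u → u) , λ u Wu → contradiction (trans (sym Wu) (W≡∅ u)) true≢false

  perfectMatching-extend : ∀ (H : Graph n) {W : VSet n} {x y} →
    W x ≡ true → W y ≡ true → adj H x y ≡ true →
    PerfectMatchingOn H ((W ─ x) ─ y) → PerfectMatchingOn H W
  perfectMatching-extend H {W} {x} {y} Wx Wy xy (p , M) = p′ , matches
    where
    x≢y : x ≢ y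
    x≢y = adj⇒≢ H xy
    p′ : Fin _ → Fin _
    p′ u = if u == x then y else (if u == y then x else p u)
    p′x : p′ x ≡ y
    p′x rewrite ==-refl x = refl
    p′y : p′ y ≡ x
    p′y rewrite ≢⇒==-false (x≢y ∘ sym) | ==-refl y = refl
    p′-other : ∀ {u} → u ≢ x → u ≢ y → p′ u ≡ p u
    p′-other u≢x u≢y rewrite ≢⇒==-false u≢x | ≢⇒==-false u≢y = refl
    matches : IsPerfectMatchingOn H W p′
    matches u Wu with u ≟ x | u ≟ y
    ... | yes refl | _ = Wy , xy , p′y
    ... | no _ | yes refl = Wx , adj-symmetric H xy , p′x
    ... | no u≢x | no u≢y with M u (─-intro (W ─ x) (─-intro W Wu u≢x) u≢y)
    ...   | W′pu , upu , ppu =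
      ∧-elimˡ (∧-elimˡ W′pu) , upu ,
      trans (p′-other (─-elimʳ W (∧-elimˡ W′pu)) (─-elimʳ (W ─ x) W′pu)) ppu

  perfectMatching-addEdge : ∀ (H : Graph n) {x y} x≢y {W p} →
    IsPerfectMatchingOn (addEdge H x y x≢y) W p → p x ≢ y → IsPerfectMatchingOn H W p
  perfectMatching-addEdge H x≢y {p = p} M px≢y u Wu with M u Wu
  ... | Wpu , upu , ppu with addEdge-elim H _ _ x≢y upu
  ...   | inj₁ upu∈H = Wpu , upu∈H , ppu
  ...   | inj₂ (inj₁ (refl , pu≡y)) = contradiction pu≡y px≢y
  ...   | inj₂ (inj₂ (refl , pu≡x)) = contradiction (trans (cong p (sym pu≡x)) ppu) px≢y

  even? : ℕ → Bool
  even? zero = true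
  even? (suc k) = not (even? k)

  odd⇒positive : ∀ {k} → even? k ≡ false → 0 < k
  odd⇒positive {suc k} _ = s≤s z≤n

  -- Starting at d and following p₁
  -- and p₂ alternately, the first arrival at a, b or c closes an alternating cycle, and exchanging the
  -- matchings along it gives a perfect matching of H itself.
  module AlternatingWalk (H : Graph n) (W : VSet n) {a b c d : Fin n} (a≢c : a ≢ c) (b≢d : b ≢ d)
    {p₁ p₂ : Fin n → Fin n}
    (M₁ : IsPerfectMatchingOn (addEdge H a c a≢c) W p₁) (p₁a : p₁ a ≡ c)
    (M₂ : IsPerfectMatchingOn (addEdge H b d b≢d) W p₂) (p₂b : p₂ b ≡ d)
    (Wa : W a ≡ true) (Wb : W b ≡ true) (Wd : W d ≡ true)
    (ab : adj H a b ≡ true) (bc : adj H b c ≡ true) (bd∉H : adj H b d ≡ false)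
    where

    b≢a : b ≢ a
    b≢a = adj⇒≢ H ab ∘ sym
    b≢c : b ≢ c
    b≢c = adj⇒≢ H bc
    d≢a : d ≢ a
    d≢a refl = true≢false (trans (sym (adj-symmetric H ab)) bd∉H)
    d≢c : d ≢ c
    d≢c refl = true≢false (trans (sym bc) bd∉H)

    p₁-edge : ∀ u → W u ≡ true → u ≢ a → u ≢ c → adj H u (p₁ u) ≡ true
    p₁-edge u Wu u≢a u≢c with addEdge-elim H a c a≢c (proj₁ (proj₂ (M₁ u Wu)))
    ... | inj₁ e = e
    ... | inj₂ (inj₁ (u≡a , _)) = contradiction u≡a u≢a
    ... | inj₂ (inj₂ (u≡c , _)) = contradiction u≡c u≢c

    p₂-edge : ∀ u → W u ≡ true → u ≢ b → u ≢ d → adj H u (p₂ u) ≡ true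
    p₂-edge u Wu u≢b u≢d with addEdge-elim H b d b≢d (proj₁ (proj₂ (M₂ u Wu)))
    ... | inj₁ e = e
    ... | inj₂ (inj₁ (u≡b , _)) = contradiction u≡b u≢b
    ... | inj₂ (inj₂ (u≡d , _)) = contradiction u≡d u≢d

    p₁c : p₁ c ≡ a
    p₁c = trans (cong p₁ (sym p₁a)) (proj₂ (proj₂ (M₁ a Wa)))

    p₂d : p₂ d ≡ b
    p₂d = trans (cong p₂ (sym p₂b)) (proj₂ (proj₂ (M₂ b Wb)))

    step : ℕ → Fin n → Fin n
    step k = if even? k then p₁ else p₂

    step-cong : ∀ i j → even? i ≡ even? j → step i ≡ step j
    step-cong i j e = cong (λ t → if t then p₁ else p₂) e

    step-W : ∀ k {u} → W u ≡ true → W (step k u) ≡ true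
    step-W k {u} Wu with even? k
    ... | true = proj₁ (M₁ u Wu)
    ... | false = proj₁ (M₂ u Wu)

    step-involutive : ∀ k {u} → W u ≡ true → step k (step k u) ≡ u
    step-involutive k {u} Wu with even? k
    ... | true = proj₂ (proj₂ (M₁ u Wu))
    ... | false = proj₂ (proj₂ (M₂ u Wu))

    step-fixfree : ∀ k {u} → W u ≡ true → step k u ≢ u
    step-fixfree k {u} Wu with even? k
    ... | true = adj⇒≢ (addEdge H a c a≢c) (proj₁ (proj₂ (M₁ u Wu))) ∘ sym
    ... | false = adj⇒≢ (addEdge H b d b≢d) (proj₁ (proj₂ (M₂ u Wu))) ∘ sym

    walk : ℕ → Fin n
    walk zero = d
    walk (suc k) = step k (walk k)

    walk-W : ∀ k → W (walk k) ≡ true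
    walk-W zero = Wd
    walk-W (suc k) = step-W k (walk-W k)

    walk-back : ∀ k → step k (walk (suc k)) ≡ walk k
    walk-back k = step-involutive k (walk-W k)

    terminal : Fin n → Bool
    terminal x = x == a ∨ (x == b ∨ x == c)

    terminal-a : terminal a ≡ true
    terminal-a rewrite ==-refl a = refl

    terminal-b : terminal b ≡ true
    terminal-b = ∨-introʳ {a = b == a} (∨-introˡ (==-refl b))

    terminal-c : terminal c ≡ true
    terminal-c = ∨-introʳ {a = c == a} (∨-introʳ {a = c == b} (==-refl c))

    terminal-elim : ∀ {x} → terminal x ≡ true → (x ≡ a ⊎ x ≡ b) ⊎ x ≡ c
    terminal-elim {x} p with ∨-elim {x == a} p
    ... | inj₁ q = inj₁ (inj₁ (==⇒≡ q))
    ... | inj₂ q with ∨-elim {x == b} q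
    ...   | inj₁ r = inj₁ (inj₂ (==⇒≡ r))
    ...   | inj₂ r = inj₂ (==⇒≡ r)

    nonterminal-≢ : ∀ {x y} → terminal x ≡ false → terminal y ≡ true → x ≢ y
    nonterminal-≢ x∉ y∈ refl = true≢false (trans (sym y∈) x∉)

    terminal-d : terminal d ≡ false
    terminal-d = ≢true⇒false λ p → [ [ d≢a , b≢d ∘ sym ]′ , d≢c ]′ (terminal-elim p)

    Avoids : ℕ → Set
    Avoids K = ∀ i → i ≤ K → terminal (walk i) ≡ false

    -- A repetition walk i ≡ walk (1 + j) yields a closer one: (1 + i, j) if steps i and j use the same
    -- matching, (i - 1, j) otherwise; at i = 0 it would force walk j ≡ p₂ d ≡ b.
    walk-injective : ∀ {K} → Avoids K → ∀ {i j} → i < j → j ≤ K → walk i ≢ walk j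
    walk-injective {K} avoid {i} {suc j} (s≤s i≤j) j<K wi≡wj with even? i ≟ᵇ even? j
    ... | yes same with m≤n⇒m<n∨m≡n i≤j
    ...   | inj₂ refl = step-fixfree i (walk-W i) (sym wi≡wj)
    ...   | inj₁ i<j with m≤n⇒m<n∨m≡n i<j
    ...     | inj₂ refl = not-¬ refl same
    ...     | inj₁ 1+i<j = walk-injective avoid 1+i<j (≤-trans (n≤1+n j) j<K)
        (trans (cong (step i) wi≡wj) (trans (cong (λ s → s (walk (suc j))) (step-cong i j same)) (walk-back j)))
    walk-injective {K} avoid {zero} {suc j} _ j<K wi≡wj | no differ =
      nonterminal-≢ (avoid j (≤-trans (n≤1+n j) j<K)) terminal-b walk-j≡b
      where
      walk-j≡b : walk j ≡ b
      walk-j≡b = begin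
        walk j                  ≡⟨ sym (walk-back j) ⟩
        step j (walk (suc j))   ≡⟨ cong (step j) (sym wi≡wj) ⟩
        step j d                ≡⟨ cong (λ s → s d) (step-cong j 1 (≢true⇒false (differ ∘ sym))) ⟩
        p₂ d                    ≡⟨ p₂d ⟩
        b                       ∎
        where open ≡-Reasoning
    walk-injective {K} avoid {suc i} {suc j} (s≤s i<j) j<K wi≡wj | no differ =
      walk-injective avoid i<j (≤-trans (n≤1+n j) j<K)
        (trans (sym (walk-back i)) (trans (cong (step i) wi≡wj)
          (trans (cong (λ s → s (walk (suc j))) (step-cong i j same)) (walk-back j))))
      where
      same : even? i ≡ even? j
      same = not-injective (¬-not differ)

    avoids-or-hits : ∀ K → Avoids K ⊎ ∃ λ k → Avoids k × terminal (walk (suc k)) ≡ true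
    avoids-or-hits zero = inj₁ λ { zero _ → terminal-d }
    avoids-or-hits (suc K) with avoids-or-hits K
    ... | inj₂ hit = inj₂ hit
    ... | inj₁ avoid with terminal (walk (suc K)) in t
    ...   | true = inj₂ (K , avoid , t)
    ...   | false = inj₁ λ i i≤1+K → [ (λ i<1+K → avoid i (≤-pred i<1+K)) , (λ { refl → t }) ]′ (m≤n⇒m<n∨m≡n i≤1+K)

    first-hit : ∃ λ k → Avoids k × terminal (walk (suc k)) ≡ true
    first-hit with avoids-or-hits n
    ... | inj₂ hit = hit
    ... | inj₁ avoid with pigeonhole (n<1+n n) (walk ∘ toℕ)
    ...   | i , j , i<j , wi≡wj = contradiction wi≡wj (walk-injective avoid i<j (≤-pred (toℕ<n j)))

    onWalk : ℕ → VSet n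
    onWalk zero x = x == walk zero
    onWalk (suc k) x = x == walk (suc k) ∨ onWalk k x

    onWalk-intro : ∀ k {i} → i ≤ k → onWalk k (walk i) ≡ true
    onWalk-intro zero {zero} _ = ==-refl (walk zero)
    onWalk-intro (suc k) {i} i≤1+k with m≤n⇒m<n∨m≡n i≤1+k
    ... | inj₂ refl = ∨-introˡ (==-refl (walk (suc k)))
    ... | inj₁ (s≤s i≤k) = ∨-introʳ {a = walk i == walk (suc k)} (onWalk-intro k i≤k)

    onWalk-elim : ∀ k {x} → onWalk k x ≡ true → ∃ λ i → i ≤ k × walk i ≡ x
    onWalk-elim zero p = zero , z≤n , sym (==⇒≡ p)
    onWalk-elim (suc k) {x} p with ∨-elim {x == walk (suc k)} p
    ... | inj₁ q = suc k , ≤-refl , sym (==⇒≡ q)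
    ... | inj₂ q with onWalk-elim k q
    ...   | i , i≤k , wi≡x = i , ≤-trans i≤k (n≤1+n k) , wi≡x

    offWalk-≢ : ∀ k {x} → onWalk k x ≡ false → ∀ {i} → i ≤ k → walk i ≢ x
    offWalk-≢ k off i≤k refl = true≢false (trans (sym (onWalk-intro k i≤k)) off)

    offWalk-intro : ∀ k {x} → (∀ {i} → i ≤ k → walk i ≢ x) → onWalk k x ≡ false
    offWalk-intro k {x} avoid = ≢true⇒false λ on → let (i , i≤k , wi≡x) = onWalk-elim k on in avoid i≤k wi≡x

    step-even : ∀ i x → even? i ≡ true → step i x ≡ p₁ x
    step-even i x e rewrite e = refl

    step-odd : ∀ i x → even? i ≡ false → step i x ≡ p₂ x
    step-odd i x e rewrite e = refl

    p₁-closed : ∀ {k} → even? k ≡ false → ∀ {i} → i ≤ k → ∃ λ j → j ≤ k × p₁ (walk i) ≡ walk j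
    p₁-closed {k} odd {i} i≤k with even? i in e
    ... | true with m≤n⇒m<n∨m≡n i≤k
    ...   | inj₂ refl = contradiction (trans (sym e) odd) true≢false
    ...   | inj₁ i<k = suc i , i<k , sym (step-even i (walk i) e)
    p₁-closed {k} odd {suc i} i≤k | false =
      i , ≤-trans (n≤1+n i) i≤k , trans (cong p₁ (step-even i (walk i) (not-false⇒true e))) (proj₂ (proj₂ (M₁ _ (walk-W i))))

    p₂-on-walk : ∀ i → (i ≡ 0 × p₂ (walk i) ≡ b) ⊎
      ((even? i ≡ false × p₂ (walk i) ≡ walk (suc i)) ⊎ ∃ λ j → i ≡ suc j × p₂ (walk i) ≡ walk j)
    p₂-on-walk zero = inj₁ (refl , p₂d)
    p₂-on-walk (suc j) with even? (suc j) in e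
    ... | false = inj₂ (inj₁ (refl , refl))
    ... | true = inj₂ (inj₂ (j , refl , trans (cong p₂ (step-odd j (walk j) (not-true⇒false e))) (proj₂ (proj₂ (M₂ _ (walk-W j))))))

    -- Both matchings pair walk 0 = d, …, walk K = b among themselves (p₂ closing up with b d), so
    -- using p₁ on the walk and p₂ elsewhere avoids both added edges.
    module ClosedAtB {k} (avoid : Avoids k) (even : even? k ≡ true) (walk≡b : walk (suc k) ≡ b) where
      K : ℕ
      K = suc k
      odd : even? K ≡ false
      odd rewrite even = refl
      q : Fin n → Fin n
      q x = if onWalk K x then p₁ x else p₂ x
      onWalk-≢ac : ∀ {u} → onWalk K u ≡ true → u ≢ a × u ≢ c
      onWalk-≢ac {u} on with onWalk-elim K on
      ... | i , i≤K , refl with m≤n⇒m<n∨m≡n i≤K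
      ...   | inj₂ refl rewrite walk≡b = b≢a , b≢c
      ...   | inj₁ (s≤s i≤k) = nonterminal-≢ (avoid i i≤k) terminal-a , nonterminal-≢ (avoid i i≤k) terminal-c
      p₂-offWalk : ∀ {u} → W u ≡ true → onWalk K u ≡ false → onWalk K (p₂ u) ≡ false
      p₂-offWalk {u} Wu off = offWalk-intro K λ {i} i≤K wi≡p₂u →
        not-partner i≤K (trans (sym (proj₂ (proj₂ (M₂ u Wu)))) (cong p₂ (sym wi≡p₂u)))
        where
        not-partner : ∀ {i} → i ≤ K → u ≢ p₂ (walk i)
        not-partner {i} i≤K u≡ with m≤n⇒m<n∨m≡n i≤K
        ... | inj₂ refl = offWalk-≢ K off z≤n (sym (trans u≡ (trans (cong p₂ walk≡b) p₂b)))
        ... | inj₁ i<K with p₂-on-walk i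
        ...   | inj₁ (_ , p₂wi≡b) = offWalk-≢ K off ≤-refl (sym (trans u≡ (trans p₂wi≡b (sym walk≡b))))
        ...   | inj₂ (inj₁ (_ , p₂wi≡next)) = offWalk-≢ K off i<K (sym (trans u≡ p₂wi≡next))
        ...   | inj₂ (inj₂ (j , refl , p₂wi≡prev)) = offWalk-≢ K off (≤-trans (n≤1+n j) i≤K) (sym (trans u≡ p₂wi≡prev))
      matches : IsPerfectMatchingOn H W q
      matches u Wu with onWalk K u in on
      ... | true with onWalk-elim K on
      ...   | i , i≤K , wi≡u with p₁-closed odd i≤K
      ...     | j , j≤K , p₁wi≡wj = proj₁ (M₁ u Wu) , p₁-edge u Wu (proj₁ (onWalk-≢ac on)) (proj₂ (onWalk-≢ac on)) , back
        where
        back : q (p₁ u) ≡ u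
        back = trans (if-true (subst (λ t → onWalk K t ≡ true) (trans (sym p₁wi≡wj) (cong p₁ wi≡u)) (onWalk-intro K j≤K)))
                     (proj₂ (proj₂ (M₁ u Wu)))
      matches u Wu | false = proj₁ (M₂ u Wu) , p₂-edge u Wu u≢b u≢d , back
        where
        u≢b : u ≢ b
        u≢b u≡b = offWalk-≢ K on ≤-refl (trans walk≡b (sym u≡b))
        u≢d : u ≢ d
        u≢d u≡d = offWalk-≢ K on z≤n (sym u≡d)
        back : q (p₂ u) ≡ u
        back = trans (if-false (p₂-offWalk Wu on)) (proj₂ (proj₂ (M₂ u Wu)))

      matching : PerfectMatchingOn H W
      matching = q , matches

    -- p₁ pairs walk 0, …, walk k among themselves, v = walk (1 + k) ∈ {a, c} is matched to b, and p₂
    -- pairs the rest, because its pairs meeting the walk or {v, b} are {walk k, v}, {d, b} and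
    -- {walk (2i - 1), walk 2i}.
    module ClosedAtAC {k} (avoid : Avoids k) (odd : even? k ≡ false)
      (v≡a∨c : walk (suc k) ≡ a ⊎ walk (suc k) ≡ c) where
      v : Fin n
      v = walk (suc k)
      v≢b : v ≢ b
      v≢b v≡b = [ (λ v≡a → b≢a (trans (sym v≡b) v≡a)) , (λ v≡c → b≢c (trans (sym v≡b) v≡c)) ]′ v≡a∨c
      vb : adj H v b ≡ true
      vb = [ (λ v≡a → subst (λ t → adj H t b ≡ true) (sym v≡a) ab) ,
             (λ v≡c → subst (λ t → adj H t b ≡ true) (sym v≡c) (adj-symmetric H bc)) ]′ v≡a∨c
      p₂v : p₂ v ≡ walk k
      p₂v = trans (cong p₂ (step-odd k (walk k) odd)) (proj₂ (proj₂ (M₂ _ (walk-W k))))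
      b-offWalk : onWalk k b ≡ false
      b-offWalk = offWalk-intro k λ i≤k → nonterminal-≢ (avoid _ i≤k) terminal-b
      v-offWalk : onWalk k v ≡ false
      v-offWalk = offWalk-intro k λ i≤k wi≡v →
        [ (λ v≡a → nonterminal-≢ (avoid _ i≤k) terminal-a (trans wi≡v v≡a)) ,
          (λ v≡c → nonterminal-≢ (avoid _ i≤k) terminal-c (trans wi≡v v≡c)) ]′ v≡a∨c
      q : Fin n → Fin n
      q x = if onWalk k x then p₁ x else (if x == v then b else (if x == b then v else p₂ x))
      q-on : ∀ {x} → onWalk k x ≡ true → q x ≡ p₁ x
      q-on = if-true
      q-v : q v ≡ b
      q-v = trans (if-false v-offWalk) (if-true (==-refl v))
      q-b : q b ≡ v
      q-b = trans (if-false b-offWalk) (trans (if-false (≢⇒==-false (v≢b ∘ sym))) (if-true (==-refl b)))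
      q-off : ∀ {x} → onWalk k x ≡ false → x ≢ v → x ≢ b → q x ≡ p₂ x
      q-off off x≢v x≢b = trans (if-false off) (trans (if-false (≢⇒==-false x≢v)) (if-false (≢⇒==-false x≢b)))
      p₂-outside : ∀ {u} → W u ≡ true → onWalk k u ≡ false → u ≢ v → u ≢ b →
        onWalk k (p₂ u) ≡ false × p₂ u ≢ v × p₂ u ≢ b
      p₂-outside {u} Wu off u≢v u≢b = offWalk-intro k not-on , not-v , not-b
        where
        partner : ∀ {z} → p₂ u ≡ z → u ≡ p₂ z
        partner e = trans (sym (proj₂ (proj₂ (M₂ u Wu)))) (cong p₂ e)
        not-v : p₂ u ≢ v
        not-v e = offWalk-≢ k off ≤-refl (sym (trans (partner e) p₂v))
        not-b : p₂ u ≢ b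
        not-b e = offWalk-≢ k off z≤n (sym (trans (partner e) p₂b))
        not-on : ∀ {i} → i ≤ k → walk i ≢ p₂ u
        not-on {i} i≤k e with p₂-on-walk i
        ... | inj₁ (_ , p₂wi≡b) = u≢b (trans (partner (sym e)) p₂wi≡b)
        ... | inj₂ (inj₂ (j , refl , p₂wi≡prev)) = offWalk-≢ k off (≤-trans (n≤1+n j) i≤k) (sym (trans (partner (sym e)) p₂wi≡prev))
        ... | inj₂ (inj₁ (_ , p₂wi≡next)) with m≤n⇒m<n∨m≡n i≤k
        ...   | inj₂ refl = u≢v (trans (partner (sym e)) p₂wi≡next)
        ...   | inj₁ i<k = offWalk-≢ k off i<k (sym (trans (partner (sym e)) p₂wi≡next))
      matches : IsPerfectMatchingOn H W q
      matches u Wu with onWalk k u in on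
      ... | true with onWalk-elim k on
      ...   | i , i≤k , wi≡u with p₁-closed odd i≤k
      ...     | j , j≤k , p₁wi≡wj =
        proj₁ (M₁ u Wu) , p₁-edge u Wu u≢a u≢c , trans (q-on p₁u-on) (proj₂ (proj₂ (M₁ u Wu)))
        where
        u≢a : u ≢ a
        u≢a = subst (_≢ a) wi≡u (nonterminal-≢ (avoid i i≤k) terminal-a)
        u≢c : u ≢ c
        u≢c = subst (_≢ c) wi≡u (nonterminal-≢ (avoid i i≤k) terminal-c)
        p₁u-on : onWalk k (p₁ u) ≡ true
        p₁u-on = subst (λ t → onWalk k t ≡ true) (trans (sym p₁wi≡wj) (cong p₁ wi≡u)) (onWalk-intro k j≤k)
      matches u Wu | false with u ≟ v
      ... | yes refl = Wb , vb , q-b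
      ... | no u≢v with u ≟ b
      ...   | yes refl = walk-W (suc k) , adj-symmetric H vb , q-v
      ...   | no u≢b with p₂-outside Wu on u≢v u≢b
      ...     | off′ , ≢v , ≢b =
        proj₁ (M₂ u Wu) , p₂-edge u Wu u≢b (λ u≡d → offWalk-≢ k on z≤n (sym u≡d)) ,
        trans (q-off off′ ≢v ≢b) (proj₂ (proj₂ (M₂ u Wu)))

      matching : PerfectMatchingOn H W
      matching = q , matches

    previous : ∀ k (p : Fin n → Fin n) {x y} → step k (walk (suc k)) ≡ p (walk (suc k)) →
      walk (suc k) ≡ x → p x ≡ y → walk k ≡ y
    previous k p step≡p e px≡y = trans (sym (walk-back k)) (trans step≡p (trans (cong p e) px≡y))

    perfectMatching : PerfectMatchingOn H W
    perfectMatching with first-hit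
    ... | k , avoid , hit with even? k in parity | terminal-elim hit
    ...   | true | inj₁ (inj₂ walk≡b) = ClosedAtB.matching avoid parity walk≡b
    ...   | true | inj₁ (inj₁ walk≡a) =
      ⊥-elim (nonterminal-≢ (avoid k ≤-refl) terminal-c (previous k p₁ (step-even k _ parity) walk≡a p₁a))
    ...   | true | inj₂ walk≡c =
      ⊥-elim (nonterminal-≢ (avoid k ≤-refl) terminal-a (previous k p₁ (step-even k _ parity) walk≡c p₁c))
    ...   | false | inj₁ (inj₁ walk≡a) = ClosedAtAC.matching avoid parity (inj₁ walk≡a)
    ...   | false | inj₂ walk≡c = ClosedAtAC.matching avoid parity (inj₂ walk≡c)
    ...   | false | inj₁ (inj₂ walk≡b) =
      ⊥-elim (walk-injective avoid (odd⇒positive parity) ≤-refl (sym (previous k p₂ (step-odd k _ parity) walk≡b p₂b)))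

  module Greedy (H : Graph n) where

    Universal : VSet n → VSet n → Set
    Universal W S = ∀ {s x} → S s ≡ true → W x ≡ true → s ≢ x → adj H s x ≡ true

    Independent : VSet n → Set
    Independent Q = ∀ {x y} → Q x ≡ true → Q y ≡ true → x ≢ y → adj H x y ≡ false

    Independent-⊆ : ∀ {P Q} → P ⊆ Q → Independent Q → Independent P
    Independent-⊆ P⊆Q indep Px Py = indep (P⊆Q _ Px) (P⊆Q _ Py)

    LargeIndependentSet : VSet n → VSet n → Set
    LargeIndependentSet W S = ∃ λ Q → Q ⊆ (W ∖ S) × count S + 2 ≤ count Q × Independent Q

    MatchingOrIndependent : VSet n → VSet n → Set
    MatchingOrIndependent W S = PerfectMatchingOn H W ⊎ LargeIndependentSet W S

    extend-by-edge : ∀ {W S x y} → (W ∖ S) x ≡ true → (W ∖ S) y ≡ true → adj H x y ≡ true →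
      MatchingOrIndependent ((W ─ x) ─ y) S → MatchingOrIndependent W S
    extend-by-edge Rx Ry xy (inj₁ M) = inj₁ (perfectMatching-extend H (∧-elimˡ Rx) (∧-elimˡ Ry) xy M)
    extend-by-edge {W} {S} Rx Ry xy (inj₂ (Q , Q⊆R , big , indep)) =
      inj₂ (Q , ⊆-trans Q⊆R (∖-monoˡ S (⊆-trans (─-⊆ _) (─-⊆ W))) , big , indep)

    extend-by-universal : ∀ {W S r s} → S ⊆ W → Universal W S → Independent (W ∖ S) →
      (W ∖ S) r ≡ true → S s ≡ true →
      MatchingOrIndependent ((W ─ r) ─ s) (S ─ s) → MatchingOrIndependent W S
    extend-by-universal {W} {S} {r} {s} S⊆W univ _ Rr Ss (inj₁ M) =
      inj₁ (perfectMatching-extend H (∧-elimˡ Rr) (S⊆W s Ss) rs M)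
      where
      rs : adj H r s ≡ true
      rs = adj-symmetric H (univ Ss (∧-elimˡ Rr) λ { refl → true≢false (trans (sym Ss) (∖-elimʳ W S Rr)) })
    extend-by-universal {W} {S} {r} {s} S⊆W univ indepR Rr Ss (inj₂ (Q′ , Q′⊆R′ , big , _)) =
      inj₂ (Q , Q⊆R , big′ , Independent-⊆ Q⊆R indepR)
      where
      Q : VSet _
      Q = Q′ ∪ (_== r)
      Q′⊆R : Q′ ⊆ (W ∖ S)
      Q′⊆R = ⊆-trans Q′⊆R′ (⊆-trans (─∖─ (W ─ r) S) (∖-monoˡ S (─-⊆ W)))
      Q⊆R : Q ⊆ (W ∖ S)
      Q⊆R z q with ∨-elim {Q′ z} q
      ... | inj₁ q′ = Q′⊆R z q′
      ... | inj₂ z≡r = subst (λ t → (W ∖ S) t ≡ true) (sym (==⇒≡ z≡r)) Rr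
      r∉Q′ : ∀ x → Q′ x ≡ true → (x == r) ≡ false
      r∉Q′ x Q′x = ≢⇒==-false (─-elimʳ W (∧-elimˡ (∧-elimˡ (Q′⊆R′ x Q′x))))
      big′ : count S + 2 ≤ count Q
      big′ = begin
        count S + 2               ≡⟨ cong (_+ 2) (count-─ S Ss) ⟩
        suc (count (S ─ s) + 2)   ≤⟨ s≤s big ⟩
        suc (count Q′)            ≡⟨ +-comm 1 (count Q′) ⟩
        count Q′ + 1              ≡⟨ sym (trans (count-∪ Q′ (_== r) r∉Q′) (cong (count Q′ +_) (count-single r))) ⟩
        count Q                   ∎
        where open ≤-Reasoning

    extend-by-universal-pair : ∀ {W S s₁ s₂} → S ⊆ W → Universal W S → (∀ x → (W ∖ S) x ≡ false) →
      S s₁ ≡ true → S s₂ ≡ true → s₁ ≢ s₂ →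
      MatchingOrIndependent ((W ─ s₁) ─ s₂) ((S ─ s₁) ─ s₂) → MatchingOrIndependent W S
    extend-by-universal-pair {W} {S} S⊆W univ _ Ss₁ Ss₂ s₁≢s₂ (inj₁ M) =
      inj₁ (perfectMatching-extend H (S⊆W _ Ss₁) (S⊆W _ Ss₂) (univ Ss₁ (S⊆W _ Ss₂) s₁≢s₂) M)
    extend-by-universal-pair {W} {S} _ _ R≡∅ _ _ _ (inj₂ (Q′ , Q′⊆R′ , big , _))
      with count-pos⇒∃ Q′ (≤-trans (s≤s z≤n) (≤-trans (m≤n+m 2 _) big))
    ... | z , Q′z = contradiction (trans (sym (Q′⊆R z Q′z)) (R≡∅ z)) true≢false
      where
      Q′⊆R : Q′ ⊆ (W ∖ S)
      Q′⊆R = ⊆-trans Q′⊆R′ (⊆-trans (─∖─ (W ─ _) (S ─ _)) (─∖─ W S))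

    independent-remainder : ∀ {W S r} → (∀ x → S x ≡ false) → Independent (W ∖ S) →
      (W ∖ S) r ≡ true → Even (count W) → LargeIndependentSet W S
    independent-remainder {W} {S} S≡∅ indep Rr even = W ∖ S , (λ _ p → p) , big , indep
      where
      |R|≡|W| : count (W ∖ S) ≡ count W
      |R|≡|W| = count-cong λ x → trans (cong (λ t → W x ∧ not t) (S≡∅ x)) (∧-identityʳ (W x))
      big : count S + 2 ≤ count (W ∖ S)
      big = subst₂ _≤_ (cong (_+ 2) (sym (count-false S≡∅))) (sym |R|≡|W|)
              (even-pos⇒≥2 even (subst (0 <_) (sym (count-─ W (∧-elimˡ Rr))) (s≤s z≤n)))

    no-edge⇒independent : ∀ {W S} → (∀ x → ((W ∖ S) x ∧ anyᵇ (λ y → (W ∖ S) y ∧ adj H x y)) ≡ false) →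
      Independent (W ∖ S)
    no-edge⇒independent no-edge {x} {y} Rx Ry _ = ∧-true⇒false Ry (anyᵇ-false _ (∧-true⇒false Rx (no-edge x)) y)

    Universal-mono : ∀ {W W′ S S′} → W′ ⊆ W → S′ ⊆ S → Universal W S → Universal W′ S′
    Universal-mono W′⊆W S′⊆S univ Ss Wx = univ (S′⊆S _ Ss) (W′⊆W _ Wx)

    Solves : ℕ → Set
    Solves k = ∀ W S → count W ≤ k → S ⊆ W → Universal W S → Even (count W) → MatchingOrIndependent W S

    solve-without-two : ∀ {k W S} → Solves k → count W ≤ suc k → Even (count W) → Universal W S →
      ∀ {x y} → W x ≡ true → W y ≡ true → x ≢ y → ∀ {S′} → S′ ⊆ S → S′ ⊆ ((W ─ x) ─ y) →
      MatchingOrIndependent ((W ─ x) ─ y) S′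
    solve-without-two {W = W} solve |W|≤1+k even univ Wx Wy x≢y S′⊆S S′⊆W′ =
      solve _ _ (≤-pred (≤-trans (n≤1+n _) (subst (_≤ _) |W| |W|≤1+k))) S′⊆W′
        (Universal-mono (⊆-trans (─-⊆ _) (─-⊆ W)) S′⊆S univ) (even-pred² (subst Even |W| even))
      where
      |W| : count W ≡ suc (suc (count ((W ─ _) ─ _)))
      |W| = trans (count-─ W Wx) (cong suc (count-─ (W ─ _) (─-intro W Wy (x≢y ∘ sym))))

    -- Match an edge inside W ∖ S if there is one, else a vertex of W ∖ S with one of S, else two
    -- vertices of S; once W ∖ S is independent and S is used up, W ∖ S is the independent set.
    matchingOrIndependent : ∀ k → Solves k
    matchingOrIndependent zero W S |W|≤0 _ _ _ =
      inj₁ (perfectMatching-empty H (count≡0⇒∅ W (n≤0⇒n≡0 |W|≤0)))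
    matchingOrIndependent (suc k) W S |W|≤1+k S⊆W univ even
      with search (λ x → (W ∖ S) x ∧ anyᵇ (λ y → (W ∖ S) y ∧ adj H x y))
    ... | inj₁ (x , p) with anyᵇ-true _ (∧-elimʳ {(W ∖ S) x} p)
    ...   | y , q = extend-by-edge {W} {S} Rx Ry xy
        (solve-without-two (matchingOrIndependent k) |W|≤1+k even univ (∧-elimˡ Rx) (∧-elimˡ Ry) (adj⇒≢ H xy)
          (λ _ s → s) (⊆-─ (⊆-─ S⊆W (∖-elimʳ W S Rx)) (∖-elimʳ W S Ry)))
      where
      Rx : (W ∖ S) x ≡ true
      Rx = ∧-elimˡ p
      Ry : (W ∖ S) y ≡ true
      Ry = ∧-elimˡ q
      xy : adj H x y ≡ true
      xy = ∧-elimʳ {(W ∖ S) y} q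
    matchingOrIndependent (suc k) W S |W|≤1+k S⊆W univ even | inj₂ no-edge with search (W ∖ S) | search S
    ...   | inj₁ (r , Rr) | inj₁ (s , Ss) =
      extend-by-universal {W} {S} S⊆W univ (no-edge⇒independent {W} {S} no-edge) Rr Ss
        (solve-without-two (matchingOrIndependent k) |W|≤1+k even univ (∧-elimˡ Rr) (S⊆W s Ss) r≢s
          (─-⊆ S) (∖-monoˡ _ (⊆-─ S⊆W (∖-elimʳ W S Rr))))
      where
      r≢s : r ≢ s
      r≢s refl = true≢false (trans (sym Ss) (∖-elimʳ W S Rr))
    ...   | inj₁ (r , Rr) | inj₂ S≡∅ = inj₂ (independent-remainder S≡∅ (no-edge⇒independent {W} {S} no-edge) Rr even)
    ...   | inj₂ R≡∅ | inj₂ S≡∅ =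
      inj₁ (perfectMatching-empty H λ x → ≢true⇒false λ Wx → true≢false (trans (sym (∖-intro W S Wx (S≡∅ x))) (R≡∅ x)))
    ...   | inj₂ R≡∅ | inj₁ (s₁ , Ss₁) with search (S ─ s₁)
    ...     | inj₁ (s₂ , S′s₂) =
      extend-by-universal-pair {W} {S} S⊆W univ R≡∅ Ss₁ (─-⊆ S _ S′s₂) (─-elimʳ S S′s₂ ∘ sym)
        (solve-without-two (matchingOrIndependent k) |W|≤1+k even univ (S⊆W _ Ss₁) (S⊆W _ (─-⊆ S _ S′s₂))
          (─-elimʳ S S′s₂ ∘ sym) (⊆-trans (─-⊆ _) (─-⊆ S)) (∖-monoˡ _ (∖-monoˡ _ S⊆W)))
    ...     | inj₂ S─s₁≡∅ = contradiction (subst Even |W|≡1 even) ¬even-1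
      where
      W⊆S : W ⊆ S
      W⊆S x Wx with S x in Sx
      ... | true = refl
      ... | false = contradiction (trans (sym (∖-intro W S Wx Sx)) (R≡∅ x)) true≢false
      |W|≡1 : count W ≡ 1
      |W|≡1 = trans (≤-antisym (count-mono W⊆S) (count-mono S⊆W)) (trans (count-─ S Ss₁) (cong suc (count-false S─s₁≡∅)))

  -- _~_ is an equivalence on W ∖ S closed under adjacency, so its classes are unions of components
  -- of H[W] − S; Q meets |S| + 2 distinct classes, which violates Tutte's condition.
  record TutteBarrier (H : Graph n) (W : VSet n) : Set where
    field
      S Q : VSet n
      _~_ : Fin n → Fin n → Bool
      S⊆W : S ⊆ W
      Q⊆W∖S : Q ⊆ (W ∖ S)
      many : count S + 2 ≤ count Q
      ~-refl : ∀ x → (x ~ x) ≡ true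
      ~-sym : ∀ {x y} → (x ~ y) ≡ true → (y ~ x) ≡ true
      ~-trans : ∀ {x y z} → (W ∖ S) x ≡ true → (W ∖ S) y ≡ true → (W ∖ S) z ≡ true →
        (x ~ y) ≡ true → (y ~ z) ≡ true → (x ~ z) ≡ true
      adj⇒~ : ∀ {x y} → (W ∖ S) x ≡ true → (W ∖ S) y ≡ true → adj H x y ≡ true → (x ~ y) ≡ true
      Q-separated : ∀ {x y} → Q x ≡ true → Q y ≡ true → (x ~ y) ≡ true → x ≡ y

  TutteBarrier-antitone : ∀ {G H : Graph n} {W} → G ⊑ H → TutteBarrier H W → TutteBarrier G W
  TutteBarrier-antitone G⊑H B = record
    { S = S ; Q = Q ; _~_ = _~_ ; S⊆W = S⊆W ; Q⊆W∖S = Q⊆W∖S ; many = many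
    ; ~-refl = ~-refl ; ~-sym = ~-sym ; ~-trans = ~-trans
    ; adj⇒~ = λ Rx Ry xy → adj⇒~ Rx Ry (G⊑H _ _ xy)
    ; Q-separated = Q-separated
    }
    where open TutteBarrier B

  MatchingOrBarrier : Graph n → VSet n → Set
  MatchingOrBarrier H W = PerfectMatchingOn H W ⊎ TutteBarrier H W

  universalVertices : Graph n → VSet n → VSet n
  universalVertices H W x = W x ∧ not (anyᵇ λ y → W y ∧ (not (y == x) ∧ not (adj H x y)))

  cherry : Graph n → VSet n → Fin n → Fin n → Fin n → Bool
  cherry H W a b c = W a ∧ (W c ∧ (adj H a b ∧ (adj H b c ∧ (not (a == c) ∧ not (adj H a c)))))

  universalVertices-universal : ∀ (H : Graph n) W → Greedy.Universal H W (universalVertices H W)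
  universalVertices-universal H W {s} {x} Us Wx s≢x = not-false⇒true
    (∧-true⇒false (false⇒not-true (≢⇒==-false (s≢x ∘ sym)))
      (∧-true⇒false Wx (anyᵇ-false _ (not-true⇒false (∧-elimʳ {W s} Us)) x)))

  CherryFree : Graph n → VSet n → Set
  CherryFree H W = ∀ a b c → (W ∖ universalVertices H W) b ≡ true → cherry H W a b c ≡ false

  -- Without cherries centred outside the universal vertices U, the components of H[W] − U are
  -- cliques, so "equal or adjacent" is the component relation.
  cliqueBarrier : ∀ (H : Graph n) W → CherryFree H W →
    Greedy.LargeIndependentSet H W (universalVertices H W) → TutteBarrier H W
  cliqueBarrier H W cherry-free (Q , Q⊆R , many , independent) = record
    { S = U ; Q = Q ; _~_ = _~_ ; S⊆W = λ x → ∧-elimˡ ; Q⊆W∖S = Q⊆R ; many = many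
    ; ~-refl = λ x → ∨-introˡ (==-refl x)
    ; ~-sym = ~-sym
    ; ~-trans = ~-trans
    ; adj⇒~ = λ {x} _ _ xy → ∨-introʳ {a = x == _} xy
    ; Q-separated = Q-separated
    }
    where
    U : VSet _
    U = universalVertices H W
    _~_ : Fin _ → Fin _ → Bool
    x ~ y = (x == y) ∨ adj H x y
    ~-sym : ∀ {x y} → (x ~ y) ≡ true → (y ~ x) ≡ true
    ~-sym {x} {y} p with ∨-elim {x == y} p
    ... | inj₁ x≡y = subst (λ t → (y ~ t) ≡ true) (sym (==⇒≡ x≡y)) (∨-introˡ (==-refl y))
    ... | inj₂ xy = ∨-introʳ {a = y == x} (adj-symmetric H xy)
    transitive : ∀ {x y z} → (W ∖ U) x ≡ true → (W ∖ U) y ≡ true → (W ∖ U) z ≡ true →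
      adj H x y ≡ true → adj H y z ≡ true → x ≢ z → adj H x z ≡ true
    transitive {x} {y} {z} Rx Ry Rz xy yz x≢z = not-false⇒true
      (∧-true⇒false (false⇒not-true (≢⇒==-false x≢z)) (∧-true⇒false yz (∧-true⇒false xy
        (∧-true⇒false (∧-elimˡ {W z} Rz) (∧-true⇒false (∧-elimˡ {W x} Rx) (cherry-free x y z Ry))))))
    ~-trans : ∀ {x y z} → (W ∖ U) x ≡ true → (W ∖ U) y ≡ true → (W ∖ U) z ≡ true →
      (x ~ y) ≡ true → (y ~ z) ≡ true → (x ~ z) ≡ true
    ~-trans {x} {y} {z} Rx Ry Rz x~y y~z with ∨-elim {x == y} x~y | ∨-elim {y == z} y~z
    ... | inj₁ x≡y | _ = subst (λ t → (t ~ z) ≡ true) (sym (==⇒≡ x≡y)) y~z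
    ... | inj₂ _ | inj₁ y≡z = subst (λ t → (x ~ t) ≡ true) (==⇒≡ y≡z) x~y
    ... | inj₂ xy | inj₂ yz with x ≟ z
    ...   | yes refl = refl
    ...   | no x≢z = transitive Rx Ry Rz xy yz x≢z
    Q-separated : ∀ {x y} → Q x ≡ true → Q y ≡ true → (x ~ y) ≡ true → x ≡ y
    Q-separated {x} {y} Qx Qy x~y with x ≟ y
    ... | yes x≡y = x≡y
    ... | no x≢y = contradiction (trans (sym x~y) (independent Qx Qy x≢y)) true≢false

  matchingOrBarrier-cherry-free : ∀ (H : Graph n) W → Even (count W) → CherryFree H W → MatchingOrBarrier H W
  matchingOrBarrier-cherry-free H W even cherry-free = map₂ (cliqueBarrier H W cherry-free)
    (Greedy.matchingOrIndependent H (count W) W (universalVertices H W) ≤-refl (λ x → ∧-elimˡ)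
      (universalVertices-universal H W) even)

  cherry-elim : ∀ (H : Graph n) W {a b c} → cherry H W a b c ≡ true →
    W a ≡ true × adj H a b ≡ true × adj H b c ≡ true × a ≢ c × adj H a c ≡ false
  cherry-elim H W {a} {b} {c} p =
    let Wa , p₁ = ∧-elim {W a} p
        _ , p₂ = ∧-elim {W c} p₁
        ab , p₃ = ∧-elim {adj H a b} p₂
        bc , p₄ = ∧-elim {adj H b c} p₃
        a≠c , ac∉H = ∧-elim {not (a == c)} p₄
    in Wa , ab , bc , ==-false⇒≢ (not-true⇒false a≠c) , not-true⇒false ac∉H

  non-universal-elim : ∀ (H : Graph n) W {b} → (W ∖ universalVertices H W) b ≡ true →
    ∃ λ d → W d ≡ true × b ≢ d × adj H b d ≡ false
  non-universal-elim H W {b} p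
    with anyᵇ-true _ (not-false⇒true (∧-true⇒false (∧-elimˡ {W b} p) (∖-elimʳ W (universalVertices H W) p)))
  ... | d , q = let Wd , d≠b∧bd∉H = ∧-elim {W d} q
                    d≠b , bd∉H = ∧-elim {not (d == b)} d≠b∧bd∉H
                in d , Wd , ==-false⇒≢ (not-true⇒false d≠b) ∘ sym , not-true⇒false bd∉H

  matchingOrBarrier-combine : ∀ (H : Graph n) W {a b c d} (a≢c : a ≢ c) (b≢d : b ≢ d) →
    W a ≡ true → W b ≡ true → W d ≡ true → adj H a b ≡ true → adj H b c ≡ true → adj H b d ≡ false →
    MatchingOrBarrier (addEdge H a c a≢c) W → MatchingOrBarrier (addEdge H b d b≢d) W →
    MatchingOrBarrier H W
  matchingOrBarrier-combine H W a≢c b≢d _ _ _ _ _ _ (inj₂ B) _ =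
    inj₂ (TutteBarrier-antitone (⊑-addEdge H _ _ a≢c) B)
  matchingOrBarrier-combine H W a≢c b≢d _ _ _ _ _ _ (inj₁ _) (inj₂ B) =
    inj₂ (TutteBarrier-antitone (⊑-addEdge H _ _ b≢d) B)
  matchingOrBarrier-combine H W {a} {b} {c} {d} a≢c b≢d Wa Wb Wd ab bc bd∉H (inj₁ (p₁ , M₁)) (inj₁ (p₂ , M₂))
    with p₁ a ≟ c | p₂ b ≟ d
  ... | no p₁a≢c | _ = inj₁ (p₁ , perfectMatching-addEdge H a≢c M₁ p₁a≢c)
  ... | yes _ | no p₂b≢d = inj₁ (p₂ , perfectMatching-addEdge H b≢d M₂ p₂b≢d)
  ... | yes p₁a | yes p₂b = inj₁ (AlternatingWalk.perfectMatching H W a≢c b≢d M₁ p₁a M₂ p₂b Wa Wb Wd ab bc bd∉H)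

  _≺_ : Graph n → Graph n → Set
  G ≺ H = nonAdjacencies G < nonAdjacencies H

  ≺-wellFounded : WellFounded (_≺_ {n})
  ≺-wellFounded = wellFounded nonAdjacencies <-wellFounded

  tutte : ∀ (H : Graph n) W → Even (count W) → MatchingOrBarrier H W
  tutte = All.wfRec ≺-wellFounded _ (λ H → ∀ W → Even (count W) → MatchingOrBarrier H W) step
    where
    step : ∀ H → (∀ {G} → G ≺ H → ∀ W → Even (count W) → MatchingOrBarrier G W) →
      ∀ W → Even (count W) → MatchingOrBarrier H W
    step H rec W even with search (λ b → (W ∖ universalVertices H W) b ∧ anyᵇ (λ a → anyᵇ (λ c → cherry H W a b c)))
    ... | inj₂ cherry-free = matchingOrBarrier-cherry-free H W even λ a b c Rb →
      anyᵇ-false _ (anyᵇ-false _ (∧-true⇒false Rb (cherry-free b)) a) c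
    ... | inj₁ (b , p) with anyᵇ-true _ (∧-elimʳ {(W ∖ universalVertices H W) b} p)
    ...   | a , q with anyᵇ-true _ q | non-universal-elim H W (∧-elimˡ p)
    ...     | c , abc | d , Wd , b≢d , bd∉H with cherry-elim H W abc
    ...       | Wa , ab , bc , a≢c , ac∉H = matchingOrBarrier-combine H W a≢c b≢d Wa (∧-elimˡ (∧-elimˡ p)) Wd ab bc bd∉H
      (rec (nonAdjacencies-addEdge H a c a≢c ac∉H) W even) (rec (nonAdjacencies-addEdge H b d b≢d bd∉H) W even)

  square-mono : ∀ {β r} → 0ℚ <ℚ β → .{{_ : NonNegative r}} → β ≤ℚ r → β *ℚ β ≤ℚ r *ℚ r
  square-mono {β} {r} 0<β β≤r =
    ℚ.≤-trans (ℚ.*-monoˡ-≤-nonNeg β {{ℚ.pos⇒nonNeg β {{positive 0<β}}}} β≤r) (ℚ.*-monoʳ-≤-nonNeg r β≤r)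

  -- q is 1 / (1 + c), given through its unnormalised form so that refl proves it for literals.
  ≤-reciprocal⇒ℕ : ∀ c k m (q : ℚ) → toℚᵘ q ≡ ℚᵘ.mkℚᵘ (ℤ.+ 1) c →
    ℤ.+ k / 1 ≤ℚ q *ℚ (ℤ.+ m / 1) → k * suc c ≤ m
  ≤-reciprocal⇒ℕ c k m q q≡ k≤qm =
    ℤ.drop‿+≤+ (subst₂ ℤ._≤_ (sym (ℤ.pos-* k (suc c))) (trans (ℤ.*-identityʳ _) (ℤ.*-identityˡ _)) cross)
    where
    integral : ∀ k → ℤ.+ k / 1 ≡ mkℚ (ℤ.+ k) 0 (coprime-sym (1-coprimeTo k))
    integral k = ℚ.normalize-coprime (coprime-sym (1-coprimeTo k))
    unnormalised : ℚᵘ.mkℚᵘ (ℤ.+ k) 0 ℚᵘ.≤ (ℚᵘ.mkℚᵘ (ℤ.+ 1) c ℚᵘ.* ℚᵘ.mkℚᵘ (ℤ.+ m) 0)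
    unnormalised = subst (λ z → ℚᵘ.mkℚᵘ (ℤ.+ k) 0 ℚᵘ.≤ (z ℚᵘ.* ℚᵘ.mkℚᵘ (ℤ.+ m) 0)) q≡
      (subst₂ (λ x y → toℚᵘ x ℚᵘ.≤ (toℚᵘ q ℚᵘ.* toℚᵘ y)) (integral k) (integral m)
        (ℚᵘ.≤-respʳ-≃ (ℚ.toℚᵘ-homo-* q (ℤ.+ m / 1)) (ℚ.toℚᵘ-mono-≤ k≤qm)))
    cross : ℤ.+ k ℤ.* ℤ.+ (suc c) ℤ.≤ (ℤ.+ 1 ℤ.* ℤ.+ m) ℤ.* ℤ.+ 1
    cross = subst (λ t → ℤ.+ k ℤ.* ℤ.+ t ℤ.≤ (ℤ.+ 1 ℤ.* ℤ.+ m) ℤ.* ℤ.+ 1) (*-identityʳ (suc c)) (ℚᵘ.drop-*≤* unnormalised)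

  RatioBound⇒ℕ : ∀ {n β} c r .{{_ : NonNegative r}} → toℚᵘ (r *ℚ r) ≡ ℚᵘ.mkℚᵘ (ℤ.+ 1) c →
    0ℚ <ℚ β → β ≤ℚ r → ∀ (X Y : Subset n) → RatioBound n β X Y →
    ∣ X ∣ * ∣ Y ∣ * suc c ≤ (n ∸ ∣ X ∣) * (n ∸ ∣ Y ∣)
  RatioBound⇒ℕ {n} c r r²≡ 0<β β≤r X Y bound =
    ≤-reciprocal⇒ℕ c (∣ X ∣ * ∣ Y ∣) m (r *ℚ r) r²≡
      (ℚ.≤-trans bound (ℚ.*-monoʳ-≤-nonNeg (ℤ.+ m / 1) {{ℚ.normalize-nonNeg m 1}} (square-mono 0<β β≤r)))
    where
    m : ℕ
    m = (n ∸ ∣ X ∣) * (n ∸ ∣ Y ∣)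

  *-mono-<-≤ʳ : ∀ {x X y Y} → x ≤ X → y < Y → 0 < X → y * x < Y * X
  *-mono-<-≤ʳ {x} {X} {y} {Y} x≤X y<Y 0<X =
    ≤-<-trans (*-monoʳ-≤ y x≤X) (*-monoˡ-< X {{>-nonZero 0<X}} y<Y)

  -- s + a ≤ 3a and s + b < 3b.
  ¬9ab≤[s+b][s+a] : ∀ {s a b} → 0 < s → s ≤ a + a → s < b + b → ¬ (a * b * 9 ≤ (s + b) * (s + a))
  ¬9ab≤[s+b][s+a] {s} {a} {b} 0<s s≤2a s<2b 9ab≤ =
    <-irrefl refl (≤-<-trans 9ab≤ (subst ((s + b) * (s + a) <_) (product a b) bound))
    where
    product : ∀ a b → (b + b + b) * (a + a + a) ≡ a * b * 9
    product = solve-∀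
    bound : (s + b) * (s + a) < (b + b + b) * (a + a + a)
    bound = *-mono-<-≤ʳ (+-monoˡ-≤ a s≤2a) (+-monoˡ-< b s<2b) (<-≤-trans 0<s (≤-trans s≤2a (m≤m+n (a + a) a)))

  -- s + a ≤ 2(a + i) and s + b < 2(b + i).
  ¬4[a+i][b+i]≤[s+b][s+a] : ∀ {s a b i} → 0 < s → s ≤ a + (i + i) → s < b + (i + i) →
    ¬ ((a + i) * (b + i) * 4 ≤ (s + b) * (s + a))
  ¬4[a+i][b+i]≤[s+b][s+a] {s} {a} {b} {i} 0<s s≤a+2i s<b+2i 4≤ =
    <-irrefl refl (≤-<-trans 4≤ (subst ((s + b) * (s + a) <_) (product a b i) bound))
    where
    product : ∀ a b i → (b + (i + i) + b) * (a + (i + i) + a) ≡ (a + i) * (b + i) * 4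
    product = solve-∀
    bound : (s + b) * (s + a) < (b + (i + i) + b) * (a + (i + i) + a)
    bound = *-mono-<-≤ʳ (+-monoˡ-≤ a s≤a+2i) (+-monoˡ-< b s<b+2i)
      (<-≤-trans 0<s (≤-trans s≤a+2i (m≤m+n (a + (i + i)) a)))

  toSubset : VSet n → Subset n
  toSubset = tabulate

  ∈-toSubset : ∀ (P : VSet n) {x} → x ∈ˢ toSubset P → P x ≡ true
  ∈-toSubset P {x} x∈P = trans (sym (lookup∘tabulate P x)) ([]=⇒lookup x∈P)

  ∣toSubset∣ : ∀ (P : VSet n) → ∣ toSubset P ∣ ≡ count P
  ∣toSubset∣ {zero} P = refl
  ∣toSubset∣ {suc n} P with P zero
  ... | true = cong suc (∣toSubset∣ (P ∘ suc))
  ... | false = ∣toSubset∣ (P ∘ suc)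

  toSubset≢⊤ : ∀ (P : VSet n) {v} → P v ≡ false → toSubset P ≢ ⊤
  toSubset≢⊤ P {v} Pv P≡⊤ = true≢false (trans (sym (lookup-replicate v true))
    (trans (cong (λ X → lookup X v) (sym P≡⊤)) (trans (lookup∘tabulate P v) Pv)))

  allBut : Fin n → VSet n
  allBut v = (λ _ → true) ─ v

  count-allBut : ∀ (v : Fin n) → n ≡ suc (count (allBut v))
  count-allBut {n} v = trans (sym (count-all {n})) (count-─ {n} (λ _ → true) {v} refl)

  module BarrierAgainstExpansion {n} (G : Graph n) (v : Fin n) (barrier : TutteBarrier G (allBut v)) where
    open TutteBarrier barrier

    R : VSet n
    R = allBut v ∖ S

    σ : ℕ
    σ = count S

    R-v : R v ≡ false
    R-v rewrite ==-refl v = refl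

    Q⊆R : Q ⊆ R
    Q⊆R = Q⊆W∖S

    n∸ : ∀ k r → count R ≡ k + r → n ∸ k ≡ suc σ + r
    n∸ k r |R| = begin
      n ∸ k                      ≡⟨ cong (_∸ k) n≡ ⟩
      (suc σ + (k + r)) ∸ k      ≡⟨ cong (_∸ k) (x∙yz≈y∙xz (suc σ) k r) ⟩
      (k + (suc σ + r)) ∸ k      ≡⟨ m+n∸m≡n k (suc σ + r) ⟩
      suc σ + r                  ∎
      where
      open ≡-Reasoning
      n≡ : n ≡ suc σ + (k + r)
      n≡ = trans (count-allBut v) (cong suc (trans (count-∖-⊆ S⊆W) (cong (σ +_) |R|)))

    module ClassUnion (P : VSet n) (P⊆Q : P ⊆ Q) where

      inClass : VSet n
      inClass x = anyᵇ λ q → P q ∧ (x ~ q)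

      A B : VSet n
      A = R ∩ inClass
      B = R ∖ inClass

      inClass-intro : ∀ {x q} → P q ≡ true → (x ~ q) ≡ true → inClass x ≡ true
      inClass-intro {x} Pq x~q = anyᵇ-intro (λ q → P q ∧ (x ~ q)) (∧-intro Pq x~q)

      inClass-elim : ∀ {x} → inClass x ≡ true → ∃ λ q → P q ≡ true × (x ~ q) ≡ true
      inClass-elim p with anyᵇ-true _ p
      ... | q , Pq∧x~q = q , ∧-elimˡ Pq∧x~q , ∧-elimʳ {P q} Pq∧x~q

      P⊆A : P ⊆ A
      P⊆A q Pq = ∧-intro (Q⊆R q (P⊆Q q Pq)) (inClass-intro Pq (~-refl q))

      Q∖P⊆B : (Q ∖ P) ⊆ B
      Q∖P⊆B q p = ∖-intro R inClass (Q⊆R q Qq) (≢true⇒false λ q∈ →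
        let (q′ , Pq′ , q~q′) = inClass-elim q∈ in
        true≢false (trans (sym Pq′) (subst (λ t → P t ≡ false) (Q-separated Qq (P⊆Q q′ Pq′) q~q′) (∖-elimʳ Q P p))))
        where
        Qq : Q q ≡ true
        Qq = ∧-elimˡ p

      adj-inClass : ∀ {x y} → A x ≡ true → R y ≡ true → adj G x y ≡ true → inClass y ≡ true
      adj-inClass {x} {y} Ax Ry xy with inClass-elim (∧-elimʳ {R x} Ax)
      ... | q , Pq , x~q = inClass-intro Pq (~-trans Ry Rx (Q⊆R q (P⊆Q q Pq)) (~-sym (adj⇒~ Rx Ry xy)) x~q)
        where
        Rx : R x ≡ true
        Rx = ∧-elimˡ Ax

      A-B-nonadjacent : ∀ {x y} → A x ≡ true → B y ≡ true → adj G x y ≡ false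
      A-B-nonadjacent Ax By = ≢true⇒false λ xy →
        true≢false (trans (sym (adj-inClass Ax (∧-elimˡ By) xy)) (∖-elimʳ R inClass By))

      |R|≡|A|+|B| : count R ≡ count A + count B
      |R|≡|A|+|B| = count-∖ R inClass

      A-v : A v ≡ false
      A-v rewrite R-v = refl

      B-v : B v ≡ false
      B-v rewrite R-v = refl

    2+σ≤|Q| : suc (suc σ) ≤ count Q
    2+σ≤|Q| = subst (_≤ count Q) (+-comm σ 2) many

    weak-expansion-fails : ∀ β → 0ℚ <ℚ β → β ≤ℚ ℤ.+ 1 / 3 → ¬ WeaklyNBetaGraph n G β
    weak-expansion-fails β 0<β β≤⅓ weak = ¬9ab≤[s+b][s+a] (s≤s z≤n) s≤2a s<2b 9ab≤
      where
      open Halves (halves Q)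
        renaming (P₁ to Q₁; P₁⊆P to Q₁⊆Q; |P|≤1+2|P₁| to |Q|≤1+2|Q₁|; |P|≤2|P∖P₁| to |Q|≤2|Q∖Q₁|)
      open ClassUnion Q₁ Q₁⊆Q
      a b : ℕ
      a = count A
      b = count B
      s≤2a : suc σ ≤ a + a
      s≤2a = ≤-pred (begin
        suc (suc σ)                ≤⟨ 2+σ≤|Q| ⟩
        count Q                    ≤⟨ |Q|≤1+2|Q₁| ⟩
        suc (count Q₁ + count Q₁)  ≤⟨ s≤s (+-mono-≤ (count-mono P⊆A) (count-mono P⊆A)) ⟩
        suc (a + a)                ∎)
        where open ≤-Reasoning
      s<2b : suc σ < b + b
      s<2b = begin
        suc (suc σ)                      ≤⟨ 2+σ≤|Q| ⟩
        count Q                          ≤⟨ |Q|≤2|Q∖Q₁| ⟩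
        count (Q ∖ Q₁) + count (Q ∖ Q₁)  ≤⟨ +-mono-≤ (count-mono Q∖P⊆B) (count-mono Q∖P⊆B) ⟩
        b + b                            ∎
        where open ≤-Reasoning
      disjoint : Disjoint (toSubset A) (toSubset B)
      disjoint x x∈A x∈B = true≢false (trans (sym (∧-elimʳ {R x} (∈-toSubset A x∈A))) (∖-elimʳ R inClass (∈-toSubset B x∈B)))
      no-edge : NoEdge G (toSubset A) (toSubset B)
      no-edge x y x∈A y∈B = A-B-nonadjacent (∈-toSubset A x∈A) (∈-toSubset B y∈B)
      9ab≤ : a * b * 9 ≤ (suc σ + b) * (suc σ + a)
      9ab≤ = subst₂ (λ p q → a * b * 9 ≤ p * q) (n∸ a b |R|≡|A|+|B|) (n∸ b a (trans |R|≡|A|+|B| (+-comm a b)))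
        (subst₂ (λ p q → p * q * 9 ≤ (n ∸ p) * (n ∸ q)) (∣toSubset∣ A) (∣toSubset∣ B)
          (RatioBound⇒ℕ 8 (ℤ.+ 1 / 3) refl 0<β β≤⅓ (toSubset A) (toSubset B)
          (weak (toSubset A) (toSubset B) (toSubset≢⊤ A A-v) (toSubset≢⊤ B B-v) disjoint no-edge)))

    complete-fails : ¬ IsComplete G
    complete-fails complete with count-pos⇒∃ Q (≤-trans (s≤s z≤n) 2+σ≤|Q|)
    ... | q₁ , Qq₁ with count-pos⇒∃ (Q ─ q₁) (≤-pred (subst (2 ≤_) (count-─ Q Qq₁) (≤-trans (s≤s (s≤s z≤n)) 2+σ≤|Q|)))
    ...   | q₂ , Q′q₂ = q₂≢q₁ (Q-separated (∧-elimˡ Q′q₂) Qq₁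
              (adj⇒~ (Q⊆R q₂ (∧-elimˡ Q′q₂)) (Q⊆R q₁ Qq₁) (complete q₂ q₁ q₂≢q₁)))
      where
      q₂≢q₁ : q₂ ≢ q₁
      q₂≢q₁ = ─-elimʳ Q Q′q₂

    others : Fin n → VSet n
    others q z = R z ∧ ((z ~ q) ∧ not (z == q))

    isolated : VSet n
    isolated q = not (anyᵇ (others q))

    isolated-elim : ∀ {q z} → isolated q ≡ true → R z ≡ true → (z ~ q) ≡ true → z ≡ q
    isolated-elim {q} {z} iso Rz z~q with z ≟ q
    ... | yes z≡q = z≡q
    ... | no z≢q = contradiction (trans (sym (anyᵇ-intro (others q) {z} other)) (not-true⇒false iso)) true≢false
      where
      other : others q z ≡ true
      other = ∧-intro Rz (∧-intro z~q (false⇒not-true (≢⇒==-false z≢q)))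

    partner : Fin n → Fin n
    partner q with search (others q)
    ... | inj₁ (z , _) = z
    ... | inj₂ _ = q

    partner-others : ∀ {q} → isolated q ≡ false → others q (partner q) ≡ true
    partner-others {q} non-isolated with search (others q)
    ... | inj₁ (_ , other) = other
    ... | inj₂ none with anyᵇ-true (others q) (not-false⇒true non-isolated)
    ...   | z , other = contradiction (trans (sym other) (none z)) true≢false

    module Partner {q} (Q′q : (Q ∖ isolated) q ≡ true) where
      non-isolated : isolated q ≡ false
      non-isolated = ∖-elimʳ Q isolated Q′q

      R-partner : R (partner q) ≡ true
      R-partner = ∧-elimˡ (partner-others non-isolated)

      partner~ : (partner q ~ q) ≡ true
      partner~ = ∧-elimˡ (∧-elimʳ {R (partner q)} (partner-others non-isolated))

      partner≢ : partner q ≢ q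
      partner≢ = ==-false⇒≢ (not-true⇒false (∧-elimʳ {partner q ~ q} (∧-elimʳ {R (partner q)} (partner-others non-isolated))))

      partner∉Q : Q (partner q) ≡ false
      partner∉Q = ≢true⇒false λ Qp → partner≢ (Q-separated Qp (∧-elimˡ Q′q) partner~)

    partner-injective : InjectiveOn (Q ∖ isolated) partner
    partner-injective x y Q′x Q′y px≡py = Q-separated (∧-elimˡ Q′x) (∧-elimˡ Q′y)
      (~-trans (Q⊆R x (∧-elimˡ Q′x)) (Partner.R-partner Q′y) (Q⊆R y (∧-elimˡ Q′y))
        (subst (λ t → (x ~ t) ≡ true) px≡py (~-sym (Partner.partner~ Q′x))) (Partner.partner~ Q′y))

    I : VSet n
    I = Q ∩ isolated

    |Q|≡|I|+|Q∖I| : count Q ≡ count I + count (Q ∖ isolated)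
    |Q|≡|I|+|Q∖I| = count-∖ Q isolated

    I⊆R : I ⊆ R
    I⊆R q Iq = Q⊆R q (∧-elimˡ Iq)

    I-nonadjacent : ∀ {x y} → I y ≡ true → R x ≡ true → adj G x y ≡ false
    I-nonadjacent {x} {y} Iy Rx = ≢true⇒false λ xy →
      adj⇒≢ G xy (isolated-elim (∧-elimʳ {Q y} Iy) Rx (adj⇒~ Rx (I⊆R y Iy) xy))

    module IsolatedSplit (Q₁ : VSet n) (Q₁⊆Q′ : Q₁ ⊆ (Q ∖ isolated)) where
      Q₁⊆Q : Q₁ ⊆ Q
      Q₁⊆Q q = ∧-elimˡ ∘ Q₁⊆Q′ q

      open ClassUnion Q₁ Q₁⊆Q public

      Q₂ : VSet n
      Q₂ = (Q ∖ isolated) ∖ Q₁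

      B′ : VSet n
      B′ = B ∖ I

      X Y : VSet n
      X = A ∪ I
      Y = B′ ∪ I

      I∉Class : ∀ {x} → I x ≡ true → inClass x ≡ false
      I∉Class {x} Ix = ≢true⇒false λ x∈ →
        let (q , Q₁q , x~q) = inClass-elim x∈
            q≡x = isolated-elim (∧-elimʳ {Q x} Ix) (Q⊆R q (Q₁⊆Q q Q₁q)) (~-sym x~q)
        in true≢false (trans (sym (∧-elimʳ {Q x} Ix)) (subst (λ t → isolated t ≡ false) q≡x (∖-elimʳ Q isolated (Q₁⊆Q′ q Q₁q))))

      I⊆B : I ⊆ B
      I⊆B x Ix = ∖-intro R inClass (I⊆R x Ix) (I∉Class Ix)

      |X| : count X ≡ count A + count I
      |X| = count-∪ A I λ x Ax → ≢true⇒false λ Ix → true≢false (trans (sym (∧-elimʳ {R x} Ax)) (I∉Class Ix))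

      |Y| : count Y ≡ count B′ + count I
      |Y| = count-∪ B′ I λ x B′x → ∖-elimʳ B I B′x

      |R| : count R ≡ count A + (count I + count B′)
      |R| = trans |R|≡|A|+|B| (cong (count A +_) (count-∖-⊆ I⊆B))

      no-edge : NoEdge G (toSubset X) (toSubset Y)
      no-edge x y x∈X y∈Y with ∨-elim {B′ y} (∈-toSubset Y y∈Y) | ∨-elim {A x} (∈-toSubset X x∈X)
      ... | inj₂ Iy | _ = I-nonadjacent Iy Rx
        where
        Rx = [ ∧-elimˡ , I⊆R x ]′ (∨-elim {A x} (∈-toSubset X x∈X))
      ... | inj₁ B′y | inj₂ Ix = trans (adj-sym G x y) (I-nonadjacent Ix (∧-elimˡ (∧-elimˡ B′y)))
      ... | inj₁ B′y | inj₁ Ax = A-B-nonadjacent Ax (∧-elimˡ B′y)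

      2|Q₁|≤|A| : count Q₁ + count Q₁ ≤ count A
      2|Q₁|≤|A| = count-≥-double partner P⊆A maps (λ x y Q₁x Q₁y → partner-injective x y (Q₁⊆Q′ x Q₁x) (Q₁⊆Q′ y Q₁y))
        where
        maps : ∀ q → Q₁ q ≡ true → (A ∖ Q₁) (partner q) ≡ true
        maps q Q₁q = ∖-intro A Q₁ (∧-intro R-partner (inClass-intro Q₁q partner~))
                       (≢true⇒false λ Q₁p → true≢false (trans (sym (Q₁⊆Q _ Q₁p)) partner∉Q))
          where open Partner (Q₁⊆Q′ q Q₁q)

      Q₂⊆B′ : Q₂ ⊆ B′
      Q₂⊆B′ q Q₂q = ∖-intro B I (Q∖P⊆B q (∖-intro Q Q₁ Qq (∖-elimʳ (Q ∖ isolated) Q₁ Q₂q)))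
                      (trans (cong (Q q ∧_) (∖-elimʳ Q isolated (∧-elimˡ Q₂q))) (∧-zeroʳ (Q q)))
        where
        Qq : Q q ≡ true
        Qq = ∧-elimˡ (∧-elimˡ Q₂q)

      2|Q₂|≤|B′| : count Q₂ + count Q₂ ≤ count B′
      2|Q₂|≤|B′| = count-≥-double partner Q₂⊆B′ maps (λ x y Q₂x Q₂y → partner-injective x y (∧-elimˡ Q₂x) (∧-elimˡ Q₂y))
        where
        maps : ∀ q → Q₂ q ≡ true → (B′ ∖ Q₂) (partner q) ≡ true
        maps q Q₂q = ∖-intro B′ Q₂ (∖-intro B I (∖-intro R inClass R-partner outside) not-I)
                       (≢true⇒false λ Q₂p → true≢false (trans (sym (∧-elimˡ (∧-elimˡ Q₂p))) partner∉Q))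
          where
          open Partner (∧-elimˡ Q₂q)
          Qq : Q q ≡ true
          Qq = ∧-elimˡ (∧-elimˡ Q₂q)
          outside : inClass (partner q) ≡ false
          outside = ≢true⇒false λ p∈ →
            let (q₁ , Q₁q₁ , p~q₁) = inClass-elim p∈
                q≡q₁ = Q-separated Qq (Q₁⊆Q q₁ Q₁q₁) (~-trans (Q⊆R q Qq) R-partner (Q⊆R q₁ (Q₁⊆Q q₁ Q₁q₁)) (~-sym partner~) p~q₁)
            in true≢false (trans (sym (subst (λ t → Q₁ t ≡ true) (sym q≡q₁) Q₁q₁)) (∖-elimʳ (Q ∖ isolated) Q₁ Q₂q))
          not-I : I (partner q) ≡ false
          not-I = ≢true⇒false λ Ip → partner≢ (sym (isolated-elim (∧-elimʳ {Q (partner q)} Ip) (Q⊆R q Qq) (~-sym partner~)))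

      X-v : X v ≡ false
      X-v rewrite A-v = ≢true⇒false λ Iv → true≢false (trans (sym (I⊆R v Iv)) R-v)

      Y-v : Y v ≡ false
      Y-v rewrite B-v = ≢true⇒false λ Iv → true≢false (trans (sym (I⊆R v Iv)) R-v)

    expansion-fails : ∀ β → 0ℚ <ℚ β → β ≤ℚ ½ →
      ¬ (∀ (X Y : Subset n) → X ≢ ⊤ → Y ≢ ⊤ → NoEdge G X Y → RatioBound n β X Y)
    expansion-fails β 0<β β≤½ expand = ¬4[a+i][b+i]≤[s+b][s+a] (s≤s z≤n) s≤a+2i s<b+2i 4≤
      where
      open Halves (halves (Q ∖ isolated))
        renaming (P₁ to Q₁; P₁⊆P to Q₁⊆Q′; |P|≤1+2|P₁| to |Q′|≤1+2|Q₁|; |P|≤2|P∖P₁| to |Q′|≤2|Q₂|)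
      open IsolatedSplit Q₁ Q₁⊆Q′
      a b i : ℕ
      a = count A
      b = count B′
      i = count I
      s≤a+2i : suc σ ≤ a + (i + i)
      s≤a+2i = ≤-pred (begin
        suc (suc σ)                         ≤⟨ 2+σ≤|Q| ⟩
        count Q                             ≡⟨ |Q|≡|I|+|Q∖I| ⟩
        i + count (Q ∖ isolated)            ≤⟨ +-monoʳ-≤ i |Q′|≤1+2|Q₁| ⟩
        i + suc (count Q₁ + count Q₁)       ≤⟨ +-monoʳ-≤ i (s≤s 2|Q₁|≤|A|) ⟩
        i + suc a                           ≡⟨ +-suc i a ⟩
        suc (i + a)                         ≤⟨ s≤s (≤-trans (≤-reflexive (+-comm i a)) (+-monoʳ-≤ a (m≤n+m i i))) ⟩
        suc (a + (i + i))                   ∎)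
        where open ≤-Reasoning
      s<b+2i : suc σ < b + (i + i)
      s<b+2i = begin
        suc (suc σ)                         ≤⟨ 2+σ≤|Q| ⟩
        count Q                             ≡⟨ |Q|≡|I|+|Q∖I| ⟩
        i + count (Q ∖ isolated)            ≤⟨ +-monoʳ-≤ i (≤-trans |Q′|≤2|Q₂| 2|Q₂|≤|B′|) ⟩
        i + b                               ≤⟨ ≤-trans (≤-reflexive (+-comm i b)) (+-monoʳ-≤ b (m≤n+m i i)) ⟩
        b + (i + i)                         ∎
        where open ≤-Reasoning
      4≤ : (a + i) * (b + i) * 4 ≤ (suc σ + b) * (suc σ + a)
      4≤ = subst₂ (λ p q → (a + i) * (b + i) * 4 ≤ p * q)
        (n∸ (a + i) b (trans |R| (sym (+-assoc a i b))))
        (n∸ (b + i) a (trans |R| (trans (+-comm a (i + b)) (cong (_+ a) (+-comm i b)))))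
        (subst₂ (λ p q → p * q * 4 ≤ (n ∸ p) * (n ∸ q)) (trans (∣toSubset∣ X) |X|) (trans (∣toSubset∣ Y) |Y|)
          (RatioBound⇒ℕ 3 ½ refl 0<β β≤½ (toSubset X) (toSubset Y)
          (expand (toSubset X) (toSubset Y) (toSubset≢⊤ X X-v) (toSubset≢⊤ Y Y-v) no-edge)))

  allBut-even : ∀ {n} → Odd n → (v : Fin n) → Even (count (allBut v))
  allBut-even (k , n≡1+2k) v = k , trans (suc-injective (trans (sym (count-allBut v)) n≡1+2k)) (cong (k +_) (+-identityʳ k))

  factorCritical-unless-barrier : ∀ {n} (G : Graph n) → Odd n →
    (∀ v → ¬ TutteBarrier G (allBut v)) → FactorCritical G
  factorCritical-unless-barrier G odd no-barrier v with tutte G (allBut v) (allBut-even odd v)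
  ... | inj₂ barrier = ⊥-elim (no-barrier v barrier)
  ... | inj₁ (p , M) = p , λ u u≢v →
    let (Wpu , upu , ppu) = M u (─-intro (λ _ → true) refl u≢v) in ─-elimʳ (λ _ → true) Wpu , upu , ppu

open import Data.Rational using (ℚ; _≤_; _<_; 0ℚ; ½; _/_)

theorem3p7 : ∀ (n : ℕ) (G : Graph n) → Odd n →
    (∀ (β : ℚ) → 0ℚ < β → β ≤ ℤ.+ 1 / 3 → WeaklyNBetaGraph n G β → FactorCritical G)
    × (∀ (β : ℚ) → 0ℚ < β → β ≤ ½ → NBetaGraph n G β → FactorCritical G)
theorem3p7 n G odd = weakly , strongly
  where
  open BarrierAgainstExpansion G
  weakly : ∀ β → 0ℚ < β → β ≤ ℤ.+ 1 / 3 → WeaklyNBetaGraph n G β → FactorCritical G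
  weakly β 0<β β≤⅓ weak = factorCritical-unless-barrier G odd λ v B → weak-expansion-fails v B β 0<β β≤⅓ weak
  strongly : ∀ β → 0ℚ < β → β ≤ ½ → NBetaGraph n G β → FactorCritical G
  strongly β 0<β β≤½ (inj₁ complete) = factorCritical-unless-barrier G odd λ v B → complete-fails v B complete
  strongly β 0<β β≤½ (inj₂ expand) =
    factorCritical-unless-barrier G odd λ v B → expansion-fails v B β 0<β β≤½ expand
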